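{- For every composition $\mathbf{s}=(s_1,\ldots,s_k)$ and every positive integer $r$, the family (indexed by primes $p$) \[ p^{w(\mathbf{s})}H^{(p)}_{pr}(\mathbf{s}):=p^{w(\mathbf{s})}\sum_{\substack{pr\geq n_1>\cdots>n_k\geq1\\ p\nmid n_1n_2\cdots n_k}}\frac{1}{n_1^{s_1}\cdots n_k^{s_k}} \] is asymptotically representable.
   Context: A composition is a finite ordered tuple $\mathbf{s}=(s_1,\ldots,s_k)$ of positive integers (empty allowed), weight $w(\mathbf{s})=\sum s_i$; $H_n(\mathbf{s})=\sum_{n\geq n_1>\cdots>n_k\geq1}n_1^{ -s_1}\cdots n_k^{ -s_k}$, $H_n(\varnothing)=1$. A collection $a_p\in\mathbb{Z}_p$ (defined for all but finitely many primes $p$) is asymptotically representable if there are coefficients $\alpha_{\mathbf{s}}\in\mathbb{Q}$, one for each composition and independent of $p$, such that for every $n\geq1$ the congruence $a_p\equiv\sum_{w(\mathbf{s})<n}\alpha_{\mathbf{s}}p^{w(\mathbf{s})}H_{p-1}(\mathbf{s})\pmod{p^n}$ holds for all sufficiently large $p$. -}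

module Defs where

open import Data.Nat as ℕ using (ℕ; zero; suc; _^_; _≤_; _<_)
open import Data.Nat.Properties using (m^n≢0)
open import Data.Nat.Divisibility using (_∣_; _∣?_)
open import Data.Nat.Primality using (Prime)
open import Data.Integer using (+_)
open import Data.Rational using (ℚ; _/_; _+_; _*_; _-_; 0ℚ; 1ℚ)
open ℚ using (denominatorℕ)
open import Data.List using (List; []; _∷_; map; _++_; concatMap; foldr)
open import Data.List.Relation.Unary.All using (All)
open import Data.Product using (Σ; ∃; _×_)
open import Relation.Nullary using (¬_; yes; no)
open import Relation.Binary.PropositionalEquality using (_≡_)

-- A composition: a list of positive integers (positivity imposed separately
-- via All (1 ≤_) where needed).
Composition : Set
Composition = List ℕ

w : List ℕ → ℕ
w [] = 0
w (s ∷ ss) = s ℕ.+ w ss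

ℕ→ℚ : ℕ → ℚ
ℕ→ℚ n = (+ n) / 1

inv-pow : ℕ → ℕ → ℚ
inv-pow j s = _/_ (+ 1) (suc j ^ s) {{m^n≢0 (suc j) s}}

-- Σ_{m=1}^{N} f m, where f is given j with m = suc j
sumTo : ℕ → (ℕ → ℚ) → ℚ
sumTo zero f = 0ℚ
sumTo (suc N) f = sumTo N f + f N

-- H_N(s) = Σ_{N ≥ n1 > ... > nk ≥ 1} 1/(n1^s1 ... nk^sk)
H : ℕ → List ℕ → ℚ
H N [] = 1ℚ
H N (s ∷ ss) = sumTo N (λ j → inv-pow j s * H j ss)

-- H^{(p)}_N(s): same sum restricted to p ∤ n1 ⋯ nk (i.e. p ∤ each n_i, p prime)
Hp : ℕ → ℕ → List ℕ → ℚ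
Hp p N [] = 1ℚ
Hp p N (s ∷ ss) = sumTo N (λ j → term j)
  where
  term : ℕ → ℚ
  term j with p ∣? suc j
  ... | yes _ = 0ℚ
  ... | no _ = inv-pow j s * Hp p j ss

-- All compositions of weight m (each exactly once):
-- compositions of m+1 are 1 ∷ c, or (c₁+1) ∷ rest, for c = c₁ ∷ rest of weight m.
bump : List ℕ → List (List ℕ)
bump [] = []
bump (c ∷ cs) = (suc c ∷ cs) ∷ []

comps : ℕ → List (List ℕ)
comps zero = [] ∷ []
comps (suc m) = map (1 ∷_) (comps m) ++ concatMap bump (comps m)

-- a ≡ b (mod p^n) in ℤ_(p): a - b = p^n * c with c p-integral
CongMod : ℕ → ℕ → ℚ → ℚ → Set
CongMod p n a b = Σ ℚ (λ c → ((a - b) ≡ (ℕ→ℚ (p ^ n) * c)) × ¬ (p ∣ denominatorℕ c))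

sumℚ : List ℚ → ℚ
sumℚ = foldr _+_ 0ℚ

truncSum : (List ℕ → ℚ) → ℕ → ℕ → ℚ
truncSum α p zero = 0ℚ
truncSum α p (suc m) = truncSum α p m
  + sumℚ (map (λ c → α c * ℕ→ℚ (p ^ m) * H (p ℕ.∸ 1) c) (comps m))

AsympRep : (ℕ → ℚ) → Set
AsympRep a = Σ (List ℕ → ℚ) λ α → (n : ℕ) → 1 ≤ n →
  Σ ℕ λ P → (p : ℕ) → Prime p → P ≤ p → CongMod p n (a p) (truncSum α p n)

-- Splitting (0, p(r+1)] into (0, pr] and the block (pr, pr+p] gives
-- H⁽ᵖ⁾_{p(r+1)}(s) = ∑_{s = ab} B(a) H⁽ᵖ⁾_{pr}(b), where B(a) is the sum over the block.
-- By induction on r it therefore suffices that representable families are closed under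
-- sums and products, and that every p^{w(a)} B(a) is representable.  Products reduce to
-- the stuffle product H_{p-1}(c) H_{p-1}(d) = ∑_u H_{p-1}(u).  In the block the indices
-- are pr + m with 0 < m < p, and p / (pr + m) = x / (1 + r x) with x = p / m; expanding
-- each factor as a power series in x rewrites p^{w(a)} B(a) as a combination of the
-- p^{w(t)} H_{p-1}(t) with coefficients independent of p.  Terms of weight ≥ n vanish
-- modulo p^n, and once p exceeds the denominators of the finitely many coefficients
-- involved, everything in sight is p-integral.

module Submission where

open import Defs
open import Data.Empty using (⊥-elim)
import Data.Integer as ℤ
import Data.Integer.Properties as ℤP
import Data.Integer.Solver as ℤSolver
open import Data.List using (List; []; _∷_; map; _++_; concatMap)
import Data.List.Properties as LP
open import Data.List.Relation.Unary.All as All using (All; []; _∷_)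
import Data.List.Relation.Unary.All.Properties as AllP
import Data.Nat
open import Data.Nat as ℕ using (ℕ; zero; suc; _^_; _≤_; _<_; z≤n; s≤s; NonZero; _⊔_)
open import Data.Nat.ListAction using (sum)
import Data.Nat.Properties as ℕP
open import Data.Nat.Divisibility as ℕD using (_∣_; _∣?_; divides)
open import Data.Nat.Primality using (Prime; euclidsLemma; prime⇒nonZero; prime⇒nonTrivial)
import Data.Nat.Solver as ℕSolver
open import Data.Product using (Σ; _×_; _,_; proj₁; proj₂)
import Data.Rational
open import Data.Rational as ℚ using (ℚ; _/_; _+_; _*_; _-_; -_; 0ℚ; 1ℚ; toℚᵘ)
import Data.Rational.Properties as ℚP
open import Algebra.Definitions.RawSemiring ℚP.+-*-rawSemiring using () renaming (_^_ to _^ᵠ_)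
import Data.Rational.Unnormalised as ℚᵘ
import Data.Rational.Unnormalised.Properties as ℚᵘP
import Data.Rational.Solver as ℚSolver
open import Data.Sum using (inj₁; inj₂)
open import Function using (_∘_)
open import Relation.Nullary using (¬_; Dec; yes; no)
open import Relation.Binary.PropositionalEquality

toℚᵘ-ℕ→ℚ : ∀ n → toℚᵘ (ℕ→ℚ n) ℚᵘ.≃ ℚᵘ.mkℚᵘ (ℤ.+ n) 0
toℚᵘ-ℕ→ℚ n = ℚP.toℚᵘ-fromℚᵘ (ℚᵘ.mkℚᵘ (ℤ.+ n) 0)

ℕ→ℚ-+ : ∀ m n → ℕ→ℚ (m ℕ.+ n) ≡ ℕ→ℚ m + ℕ→ℚ n
ℕ→ℚ-+ m n = ℚP.toℚᵘ-injective (begin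
  toℚᵘ (ℕ→ℚ (m ℕ.+ n))                 ≈⟨ toℚᵘ-ℕ→ℚ (m ℕ.+ n) ⟩
  ℚᵘ.mkℚᵘ (ℤ.+ (m ℕ.+ n)) 0              ≈⟨ ℚᵘ.*≡* (cong (ℤ._* ℤ.+ 1) (sym unit-denominators)) ⟩
  ℚᵘ.mkℚᵘ (ℤ.+ m) 0 ℚᵘ.+ ℚᵘ.mkℚᵘ (ℤ.+ n) 0  ≈⟨ ℚᵘP.+-cong (toℚᵘ-ℕ→ℚ m) (toℚᵘ-ℕ→ℚ n) ⟨
  toℚᵘ (ℕ→ℚ m) ℚᵘ.+ toℚᵘ (ℕ→ℚ n)      ≈⟨ ℚP.toℚᵘ-homo-+ (ℕ→ℚ m) (ℕ→ℚ n) ⟨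
  toℚᵘ (ℕ→ℚ m + ℕ→ℚ n)                 ∎)
  where
  open ℚᵘP.≃-Reasoning
  unit-denominators : ℤ.+ m ℤ.* ℤ.+ 1 ℤ.+ ℤ.+ n ℤ.* ℤ.+ 1 ≡ ℤ.+ (m ℕ.+ n)
  unit-denominators rewrite ℤP.*-identityʳ (ℤ.+ m) | ℤP.*-identityʳ (ℤ.+ n) = sym (ℤP.pos-+ m n)

ℕ→ℚ-* : ∀ m n → ℕ→ℚ (m ℕ.* n) ≡ ℕ→ℚ m * ℕ→ℚ n
ℕ→ℚ-* m n = ℚP.toℚᵘ-injective (begin
  toℚᵘ (ℕ→ℚ (m ℕ.* n))                 ≈⟨ toℚᵘ-ℕ→ℚ (m ℕ.* n) ⟩
  ℚᵘ.mkℚᵘ (ℤ.+ (m ℕ.* n)) 0              ≈⟨ ℚᵘ.*≡* (cong (ℤ._* ℤ.+ 1) (ℤP.pos-* m n)) ⟩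
  ℚᵘ.mkℚᵘ (ℤ.+ m) 0 ℚᵘ.* ℚᵘ.mkℚᵘ (ℤ.+ n) 0  ≈⟨ ℚᵘP.*-cong (toℚᵘ-ℕ→ℚ m) (toℚᵘ-ℕ→ℚ n) ⟨
  toℚᵘ (ℕ→ℚ m) ℚᵘ.* toℚᵘ (ℕ→ℚ n)      ≈⟨ ℚP.toℚᵘ-homo-* (ℕ→ℚ m) (ℕ→ℚ n) ⟨
  toℚᵘ (ℕ→ℚ m * ℕ→ℚ n)                 ∎)
  where open ℚᵘP.≃-Reasoning

ℕ→ℚ-*-inverse : ∀ m .{{_ : NonZero m}} → ℕ→ℚ m * (ℤ.+ 1 / m) ≡ 1ℚ
ℕ→ℚ-*-inverse m@(suc k) = ℚP.toℚᵘ-injective (begin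
  toℚᵘ (ℕ→ℚ m * (ℤ.+ 1 / m))                    ≈⟨ ℚP.toℚᵘ-homo-* (ℕ→ℚ m) (ℤ.+ 1 / m) ⟩
  toℚᵘ (ℕ→ℚ m) ℚᵘ.* toℚᵘ (ℤ.+ 1 / m)           ≈⟨ ℚᵘP.*-cong (toℚᵘ-ℕ→ℚ m) (ℚP.toℚᵘ-fromℚᵘ (ℚᵘ.mkℚᵘ (ℤ.+ 1) k)) ⟩
  ℚᵘ.mkℚᵘ (ℤ.+ m) 0 ℚᵘ.* ℚᵘ.mkℚᵘ (ℤ.+ 1) k       ≈⟨ ℚᵘ.*≡* cross-multiplied ⟩
  ℚᵘ.1ℚᵘ                                      ∎)
  where
  open ℚᵘP.≃-Reasoning
  open ℤSolver.+-*-Solver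
  cross-multiplied : (ℤ.+ m ℤ.* ℤ.+ 1) ℤ.* ℤ.+ 1 ≡ ℤ.+ 1 ℤ.* ℤ.+ (1 ℕ.* m)
  cross-multiplied = trans (solve 1 (λ a → (a :* con (ℤ.+ 1)) :* con (ℤ.+ 1) := con (ℤ.+ 1) :* a) refl (ℤ.+ m))
    (cong (λ i → ℤ.+ 1 ℤ.* ℤ.+ i) (sym (ℕP.*-identityˡ m)))

_^ℚ_ : ℕ → ℕ → ℚ
p ^ℚ n = ℕ→ℚ (p ^ n)

^ℚ-+ : ∀ p m n → p ^ℚ (m ℕ.+ n) ≡ p ^ℚ m * p ^ℚ n
^ℚ-+ p m n = trans (cong ℕ→ℚ (ℕP.^-distribˡ-+-* p m n)) (ℕ→ℚ-* (p ^ m) (p ^ n))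

inv-pow-inverse : ∀ j s → ℕ→ℚ (suc j ^ s) * inv-pow j s ≡ 1ℚ
inv-pow-inverse j s = ℕ→ℚ-*-inverse (suc j ^ s) {{ℕP.m^n≢0 (suc j) s}}

*-inverse-unique : ∀ k x y → k * x ≡ 1ℚ → k * y ≡ 1ℚ → x ≡ y
*-inverse-unique k x y kx≡1 ky≡1 = begin
  x            ≡⟨ ℚP.*-identityʳ x ⟨
  x * 1ℚ       ≡⟨ cong (x *_) ky≡1 ⟨
  x * (k * y)  ≡⟨ ℚP.*-assoc x k y ⟨
  (x * k) * y  ≡⟨ cong (_* y) (trans (ℚP.*-comm x k) kx≡1) ⟩
  1ℚ * y       ≡⟨ ℚP.*-identityˡ y ⟩
  y            ∎
  where open ≡-Reasoning

inv-pow-+ : ∀ j a b → inv-pow j a * inv-pow j b ≡ inv-pow j (a ℕ.+ b)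
inv-pow-+ j a b = *-inverse-unique (ℕ→ℚ (m ^ (a ℕ.+ b))) _ _ product-inverse (inv-pow-inverse j (a ℕ.+ b))
  where
  m = suc j
  open ℚSolver.+-*-Solver
  product-inverse : ℕ→ℚ (m ^ (a ℕ.+ b)) * (inv-pow j a * inv-pow j b) ≡ 1ℚ
  product-inverse = begin
    ℕ→ℚ (m ^ (a ℕ.+ b)) * (inv-pow j a * inv-pow j b)
      ≡⟨ cong (_* (inv-pow j a * inv-pow j b)) (^ℚ-+ m a b) ⟩
    (ℕ→ℚ (m ^ a) * ℕ→ℚ (m ^ b)) * (inv-pow j a * inv-pow j b)
      ≡⟨ solve 4 (λ A B x y → (A :* B) :* (x :* y) := (A :* x) :* (B :* y)) refl (ℕ→ℚ (m ^ a)) (ℕ→ℚ (m ^ b)) (inv-pow j a) (inv-pow j b) ⟩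
    (ℕ→ℚ (m ^ a) * inv-pow j a) * (ℕ→ℚ (m ^ b) * inv-pow j b)
      ≡⟨ cong₂ _*_ (inv-pow-inverse j a) (inv-pow-inverse j b) ⟩
    1ℚ * 1ℚ
      ≡⟨⟩
    1ℚ ∎
    where open ≡-Reasoning

-- p-integral rationals and congruences modulo powers of p

∣-abs : ∀ a {g b} → a ℤ.* g ≡ b → ℤ.∣ a ∣ ∣ ℤ.∣ b ∣
∣-abs a {g} refl = divides ℤ.∣ g ∣ (trans (ℤP.abs-* a g) (ℕP.*-comm ℤ.∣ a ∣ ℤ.∣ g ∣))

↧ₙ-+-∣ : ∀ x y → ℚ.↧ₙ (x + y) ∣ ℚ.↧ₙ x ℕ.* ℚ.↧ₙ y
↧ₙ-+-∣ x y = subst (ℚ.↧ₙ (x + y) ∣_) (ℤP.abs-* (ℚ.↧ x) (ℚ.↧ y)) (∣-abs (ℚ.↧ (x + y)) (ℚP.↧-+ x y))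

↧ₙ-*-∣ : ∀ x y → ℚ.↧ₙ (x * y) ∣ ℚ.↧ₙ x ℕ.* ℚ.↧ₙ y
↧ₙ-*-∣ x y = subst (ℚ.↧ₙ (x * y) ∣_) (ℤP.abs-* (ℚ.↧ x) (ℚ.↧ y)) (∣-abs (ℚ.↧ (x * y)) (ℚP.↧-* x y))

↧ₙ-/-∣ : ∀ i d .{{_ : NonZero d}} → ℚ.↧ₙ (i / d) ∣ d
↧ₙ-/-∣ i d = ∣-abs (ℚ.↧ (i / d)) (ℚP.↧-/ i d)

record Integral (p : ℕ) (x : ℚ) : Set where
  constructor integral
  field p∤↧x : ¬ p ∣ ℚ.↧ₙ x

infix 4 _≡_[mod_^_]
record _≡_[mod_^_] (a b : ℚ) (p n : ℕ) : Set where
  constructor congruent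
  field
    quotient : ℚ
    quotient-integral : Integral p quotient
    difference : a - b ≡ p ^ℚ n * quotient

≡mod⇒CongMod : ∀ {p n a b} → a ≡ b [mod p ^ n ] → CongMod p n a b
≡mod⇒CongMod (congruent c (integral p∤c) eq) = c , eq , p∤c

module _ {p : ℕ} ⦃ p-prime : Prime p ⦄ where

  p∤* : ∀ {a b} → ¬ p ∣ a → ¬ p ∣ b → ¬ p ∣ a ℕ.* b
  p∤* {a} {b} p∤a p∤b p∣ab with euclidsLemma a b p-prime p∣ab
  ... | inj₁ p∣a = p∤a p∣a
  ... | inj₂ p∣b = p∤b p∣b

  p∤1 : ¬ p ∣ 1
  p∤1 p∣1 = ℕP.<⇒≢ (ℕ.nonTrivial⇒n>1 p {{prime⇒nonTrivial p-prime}}) (sym (ℕD.∣1⇒≡1 p∣1))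

  p∤^ : ∀ {a} s → ¬ p ∣ a → ¬ p ∣ a ^ s
  p∤^ zero    p∤a = p∤1
  p∤^ (suc s) p∤a = p∤* p∤a (p∤^ s p∤a)

  p∤-nonzero-< : ∀ {k} → 0 < k → k < p → ¬ p ∣ k
  p∤-nonzero-< {suc k} _ k<p p∣k = ℕP.<⇒≱ k<p (ℕD.∣⇒≤ p∣k)

  integral-+ : ∀ {x y} → Integral p x → Integral p y → Integral p (x + y)
  integral-+ {x} {y} (integral p∤x) (integral p∤y) =
    integral (λ p∣ → p∤* p∤x p∤y (ℕD.∣-trans p∣ (↧ₙ-+-∣ x y)))

  integral-* : ∀ {x y} → Integral p x → Integral p y → Integral p (x * y)
  integral-* {x} {y} (integral p∤x) (integral p∤y) =
    integral (λ p∣ → p∤* p∤x p∤y (ℕD.∣-trans p∣ (↧ₙ-*-∣ x y)))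

  integral-neg : ∀ {x} → Integral p x → Integral p (- x)
  integral-neg {x} (integral p∤x) = integral (λ p∣ → p∤x (subst (p ∣_) (cong ℤ.∣_∣ (ℚP.↧-neg x)) p∣))

  integral-/ : ∀ i d .{{_ : NonZero d}} → ¬ p ∣ d → Integral p (i / d)
  integral-/ i d p∤d = integral (λ p∣ → p∤d (ℕD.∣-trans p∣ (↧ₙ-/-∣ i d)))

  integral-ℕ : ∀ n → Integral p (ℕ→ℚ n)
  integral-ℕ n = integral-/ (ℤ.+ n) 1 p∤1

  integral-0 : Integral p 0ℚ
  integral-0 = integral-ℕ 0

  integral-1 : Integral p 1ℚ
  integral-1 = integral-ℕ 1

  integral-^ℚ : ∀ n → Integral p (p ^ℚ n)
  integral-^ℚ n = integral-ℕ (p ^ n)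

  integral-inv-pow : ∀ j s → ¬ p ∣ suc j → Integral p (inv-pow j s)
  integral-inv-pow j s p∤ = integral-/ (ℤ.+ 1) (suc j ^ s) {{ℕP.m^n≢0 (suc j) s}} (p∤^ s p∤)

  open ℚSolver.+-*-Solver

  ≡⇒≡mod : ∀ {n a b} → a ≡ b → a ≡ b [mod p ^ n ]
  ≡⇒≡mod {n} {a} refl = congruent 0ℚ integral-0 (trans (ℚP.+-inverseʳ a) (sym (ℚP.*-zeroʳ (p ^ℚ n))))

  ≡mod-refl : ∀ {n a} → a ≡ a [mod p ^ n ]
  ≡mod-refl = ≡⇒≡mod refl

  ≡mod-sym : ∀ {n a b} → a ≡ b [mod p ^ n ] → b ≡ a [mod p ^ n ]
  ≡mod-sym {n} {a} {b} (congruent c ic eq) = congruent (- c) (integral-neg ic) (begin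
    b - a              ≡⟨ solve 2 (λ a b → b :- a := :- (a :- b)) refl a b ⟩
    - (a - b)          ≡⟨ cong -_ eq ⟩
    - (p ^ℚ n * c)     ≡⟨ solve 2 (λ x c → :- (x :* c) := x :* (:- c)) refl (p ^ℚ n) c ⟩
    p ^ℚ n * (- c)     ∎)
    where open ≡-Reasoning

  ≡mod-trans : ∀ {n a b d} → a ≡ b [mod p ^ n ] → b ≡ d [mod p ^ n ] → a ≡ d [mod p ^ n ]
  ≡mod-trans {n} {a} {b} {d} (congruent c ic eq) (congruent c′ ic′ eq′) =
    congruent (c + c′) (integral-+ ic ic′) (begin
      a - d                        ≡⟨ solve 3 (λ a b d → a :- d := (a :- b) :+ (b :- d)) refl a b d ⟩
      (a - b) + (b - d)            ≡⟨ cong₂ _+_ eq eq′ ⟩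
      p ^ℚ n * c + p ^ℚ n * c′     ≡⟨ ℚP.*-distribˡ-+ (p ^ℚ n) c c′ ⟨
      p ^ℚ n * (c + c′)            ∎)
    where open ≡-Reasoning

  ≡mod-+ : ∀ {n a b a′ b′} → a ≡ b [mod p ^ n ] → a′ ≡ b′ [mod p ^ n ] → a + a′ ≡ b + b′ [mod p ^ n ]
  ≡mod-+ {n} {a} {b} {a′} {b′} (congruent c ic eq) (congruent c′ ic′ eq′) =
    congruent (c + c′) (integral-+ ic ic′) (begin
      (a + a′) - (b + b′)          ≡⟨ solve 4 (λ a b a′ b′ → (a :+ a′) :- (b :+ b′) := (a :- b) :+ (a′ :- b′)) refl a b a′ b′ ⟩
      (a - b) + (a′ - b′)          ≡⟨ cong₂ _+_ eq eq′ ⟩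
      p ^ℚ n * c + p ^ℚ n * c′     ≡⟨ ℚP.*-distribˡ-+ (p ^ℚ n) c c′ ⟨
      p ^ℚ n * (c + c′)            ∎)
    where open ≡-Reasoning

  ≡mod-* : ∀ {n a b a′ b′} → Integral p a → Integral p b′ →
           a ≡ b [mod p ^ n ] → a′ ≡ b′ [mod p ^ n ] → a * a′ ≡ b * b′ [mod p ^ n ]
  ≡mod-* {n} {a} {b} {a′} {b′} ia ib′ (congruent c ic eq) (congruent c′ ic′ eq′) =
    congruent (a * c′ + c * b′) (integral-+ (integral-* ia ic′) (integral-* ic ib′)) (begin
      a * a′ - b * b′                      ≡⟨ solve 4 (λ a b a′ b′ → a :* a′ :- b :* b′ := a :* (a′ :- b′) :+ (a :- b) :* b′) refl a b a′ b′ ⟩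
      a * (a′ - b′) + (a - b) * b′         ≡⟨ cong₂ (λ u v → a * u + v * b′) eq′ eq ⟩
      a * (x * c′) + (x * c) * b′          ≡⟨ solve 5 (λ a x c′ c b′ → a :* (x :* c′) :+ (x :* c) :* b′ := x :* (a :* c′ :+ c :* b′)) refl a x c′ c b′ ⟩
      x * (a * c′ + c * b′)                ∎)
    where
    open ≡-Reasoning
    x = p ^ℚ n

  ≡mod-*ˡ : ∀ {n a b} k → Integral p k → a ≡ b [mod p ^ n ] → k * a ≡ k * b [mod p ^ n ]
  ≡mod-*ˡ {n} {a} {b} k ik (congruent c ic eq) = congruent (k * c) (integral-* ik ic) (begin
    k * a - k * b        ≡⟨ solve 3 (λ k a b → k :* a :- k :* b := k :* (a :- b)) refl k a b ⟩
    k * (a - b)          ≡⟨ cong (k *_) eq ⟩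
    k * (p ^ℚ n * c)     ≡⟨ solve 3 (λ k x c → k :* (x :* c) := x :* (k :* c)) refl k (p ^ℚ n) c ⟩
    p ^ℚ n * (k * c)     ∎)
    where open ≡-Reasoning

  ^ℚ-*-≡mod-0 : ∀ {n} m c → n ≤ m → Integral p c → p ^ℚ m * c ≡ 0ℚ [mod p ^ n ]
  ^ℚ-*-≡mod-0 {n} m c n≤m ic = congruent (p ^ℚ (m ℕ.∸ n) * c) (integral-* (integral-^ℚ (m ℕ.∸ n)) ic) (begin
    p ^ℚ m * c - 0ℚ                        ≡⟨ solve 2 (λ x c → x :* c :- con 0ℚ := x :* c) refl (p ^ℚ m) c ⟩
    p ^ℚ m * c                             ≡⟨ cong (λ k → p ^ℚ k * c) (ℕP.m+[n∸m]≡n n≤m) ⟨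
    p ^ℚ (n ℕ.+ (m ℕ.∸ n)) * c             ≡⟨ cong (_* c) (^ℚ-+ p n (m ℕ.∸ n)) ⟩
    (p ^ℚ n * p ^ℚ (m ℕ.∸ n)) * c          ≡⟨ ℚP.*-assoc (p ^ℚ n) _ c ⟩
    p ^ℚ n * (p ^ℚ (m ℕ.∸ n) * c)          ∎)
    where open ≡-Reasoning

  ≡mod-^0 : ∀ {a b} → Integral p a → Integral p b → a ≡ b [mod p ^ 0 ]
  ≡mod-^0 {a} {b} ia ib = congruent (a - b) (integral-+ ia (integral-neg ib)) (sym (ℚP.*-identityˡ (a - b)))

  ≡mod-integral : ∀ {n a b} → a ≡ b [mod p ^ n ] → Integral p b → Integral p a
  ≡mod-integral {n} {a} {b} (congruent c ic eq) ib =
    subst (Integral p) a-as-sum (integral-+ (integral-* (integral-^ℚ n) ic) ib)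
    where
    open ≡-Reasoning
    a-as-sum : p ^ℚ n * c + b ≡ a
    a-as-sum = begin
      p ^ℚ n * c + b   ≡⟨ cong (_+ b) eq ⟨
      (a - b) + b      ≡⟨ solve 2 (λ a b → (a :- b) :+ b := a) refl a b ⟩
      a                ∎

∑ : {A : Set} → List A → (A → ℚ) → ℚ
∑ xs f = sumℚ (map f xs)

syntax ∑ xs (λ x → e) = ∑[ x ← xs ] e

module _ {A : Set} where

  ∑-++ : ∀ (xs ys : List A) f → ∑ (xs ++ ys) f ≡ ∑ xs f + ∑ ys f
  ∑-++ []       ys f = sym (ℚP.+-identityˡ _)
  ∑-++ (x ∷ xs) ys f = trans (cong (f x +_) (∑-++ xs ys f)) (sym (ℚP.+-assoc (f x) _ _))

  ∑-cong : ∀ (xs : List A) {f g} → (∀ x → f x ≡ g x) → ∑ xs f ≡ ∑ xs g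
  ∑-cong []       f≡g = refl
  ∑-cong (x ∷ xs) f≡g = cong₂ _+_ (f≡g x) (∑-cong xs f≡g)

  ∑-congᴬ : ∀ {P : A → Set} {xs f g} → All P xs → (∀ {x} → P x → f x ≡ g x) → ∑ xs f ≡ ∑ xs g
  ∑-congᴬ []         f≡g = refl
  ∑-congᴬ (px ∷ pxs) f≡g = cong₂ _+_ (f≡g px) (∑-congᴬ pxs f≡g)

  ∑-+ : ∀ (xs : List A) f g → ∑[ x ← xs ] (f x + g x) ≡ ∑ xs f + ∑ xs g
  ∑-+ []       f g = refl
  ∑-+ (x ∷ xs) f g = trans (cong (f x + g x +_) (∑-+ xs f g))
    (solve 4 (λ a b c d → (a :+ b) :+ (c :+ d) := (a :+ c) :+ (b :+ d)) refl (f x) (g x) (∑ xs f) (∑ xs g))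
    where open ℚSolver.+-*-Solver

  ∑-*ˡ : ∀ (xs : List A) c f → c * ∑ xs f ≡ ∑[ x ← xs ] (c * f x)
  ∑-*ˡ []       c f = ℚP.*-zeroʳ c
  ∑-*ˡ (x ∷ xs) c f = trans (ℚP.*-distribˡ-+ c (f x) _) (cong (c * f x +_) (∑-*ˡ xs c f))

  ∑-*ʳ : ∀ (xs : List A) c f → ∑ xs f * c ≡ ∑[ x ← xs ] (f x * c)
  ∑-*ʳ xs c f = trans (ℚP.*-comm _ c) (trans (∑-*ˡ xs c f) (∑-cong xs (λ x → ℚP.*-comm c (f x))))

  ∑-0 : ∀ (xs : List A) → ∑[ x ← xs ] 0ℚ ≡ 0ℚ
  ∑-0 []       = refl
  ∑-0 (x ∷ xs) = trans (ℚP.+-identityˡ _) (∑-0 xs)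

  ∑-zero : ∀ (xs : List A) {f} → (∀ x → f x ≡ 0ℚ) → ∑ xs f ≡ 0ℚ
  ∑-zero xs f≡0 = trans (∑-cong xs f≡0) (∑-0 xs)

  ∑-zeroᴬ : ∀ {P : A → Set} {xs} f → All P xs → (∀ {x} → P x → f x ≡ 0ℚ) → ∑ xs f ≡ 0ℚ
  ∑-zeroᴬ {xs = xs} f pxs f≡0 = trans (∑-congᴬ pxs f≡0) (∑-0 xs)

  ∑-map : ∀ {B : Set} (g : B → A) (ys : List B) f → ∑ (map g ys) f ≡ ∑ ys (f ∘ g)
  ∑-map g []       f = refl
  ∑-map g (y ∷ ys) f = cong (f (g y) +_) (∑-map g ys f)

  ∑-concatMap : ∀ {B : Set} (g : B → List A) (ys : List B) f → ∑ (concatMap g ys) f ≡ ∑[ y ← ys ] ∑ (g y) f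
  ∑-concatMap g []       f = refl
  ∑-concatMap g (y ∷ ys) f = trans (∑-++ (g y) (concatMap g ys) f) (cong (∑ (g y) f +_) (∑-concatMap g ys f))

∑-comm : ∀ {A B : Set} (xs : List A) (ys : List B) (f : A → B → ℚ) →
         ∑[ x ← xs ] ∑ ys (f x) ≡ ∑[ y ← ys ] ∑[ x ← xs ] f x y
∑-comm []       ys f = sym (∑-0 ys)
∑-comm (x ∷ xs) ys f = trans (cong (∑ ys (f x) +_) (∑-comm xs ys f)) (sym (∑-+ ys (f x) _))

∑-*-∑ : ∀ {A B : Set} (xs : List A) (ys : List B) f g → ∑ xs f * ∑ ys g ≡ ∑[ x ← xs ] ∑[ y ← ys ] (f x * g y)
∑-*-∑ xs ys f g = trans (∑-*ʳ xs (∑ ys g) f) (∑-cong xs (λ x → ∑-*ˡ ys (f x) g))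

sumTo-cong : ∀ N {f g} → (∀ j → j < N → f j ≡ g j) → sumTo N f ≡ sumTo N g
sumTo-cong zero    f≡g = refl
sumTo-cong (suc N) f≡g = cong₂ _+_ (sumTo-cong N (λ j j<N → f≡g j (ℕP.m<n⇒m<1+n j<N))) (f≡g N ℕP.≤-refl)

sumTo-*ˡ : ∀ N c f → c * sumTo N f ≡ sumTo N (λ j → c * f j)
sumTo-*ˡ zero    c f = ℚP.*-zeroʳ c
sumTo-*ˡ (suc N) c f = trans (ℚP.*-distribˡ-+ c _ (f N)) (cong (_+ c * f N) (sumTo-*ˡ N c f))

sumTo-zero : ∀ N f → (∀ j → j < N → f j ≡ 0ℚ) → sumTo N f ≡ 0ℚ
sumTo-zero N f f≡0 = trans (sumTo-cong N f≡0) (zeros N)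
  where
  zeros : ∀ N → sumTo N (λ _ → 0ℚ) ≡ 0ℚ
  zeros zero    = refl
  zeros (suc N) = trans (ℚP.+-identityʳ _) (zeros N)

∑-sumTo-comm : ∀ {A : Set} (xs : List A) N (f : A → ℕ → ℚ) →
               ∑[ x ← xs ] sumTo N (f x) ≡ sumTo N (λ j → ∑[ x ← xs ] f x j)
∑-sumTo-comm xs zero    f = ∑-0 xs
∑-sumTo-comm xs (suc N) f = trans (∑-+ xs (λ x → sumTo N (f x)) (λ x → f x N))
  (cong (_+ ∑[ x ← xs ] f x N) (∑-sumTo-comm xs N f))

module _ {p : ℕ} ⦃ p-prime : Prime p ⦄ where

  ∑-integral : ∀ {A : Set} {P : A → Set} {xs} f → All P xs → (∀ {x} → P x → Integral p (f x)) → Integral p (∑ xs f)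
  ∑-integral f []         if = integral-0
  ∑-integral f (px ∷ pxs) if = integral-+ (if px) (∑-integral f pxs if)

  ∑-≡mod : ∀ {n} {A : Set} {P : A → Set} {xs} f g → All P xs →
           (∀ {x} → P x → f x ≡ g x [mod p ^ n ]) → ∑ xs f ≡ ∑ xs g [mod p ^ n ]
  ∑-≡mod f g []         f≡g = ≡mod-refl
  ∑-≡mod f g (px ∷ pxs) f≡g = ≡mod-+ (f≡g px) (∑-≡mod f g pxs f≡g)

  sumTo-integral : ∀ N f → (∀ j → j < N → Integral p (f j)) → Integral p (sumTo N f)
  sumTo-integral zero    f if = integral-0
  sumTo-integral (suc N) f if = integral-+ (sumTo-integral N f (λ j j<N → if j (ℕP.m<n⇒m<1+n j<N))) (if N ℕP.≤-refl)

  sumTo-≡mod : ∀ {n} N f g → (∀ j → j < N → f j ≡ g j [mod p ^ n ]) → sumTo N f ≡ sumTo N g [mod p ^ n ]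
  sumTo-≡mod zero    f g f≡g = ≡mod-refl
  sumTo-≡mod (suc N) f g f≡g = ≡mod-+ (sumTo-≡mod N f g (λ j j<N → f≡g j (ℕP.m<n⇒m<1+n j<N))) (f≡g N ℕP.≤-refl)

IsComposition : List ℕ → Set
IsComposition = All (1 ≤_)

comps-weight : ∀ m → All (λ t → IsComposition t × w t ≡ m) (comps m)
comps-weight zero    = ([] , refl) ∷ []
comps-weight (suc m) = AllP.++⁺
  (AllP.map⁺ (All.map (λ (ct , wt≡m) → (s≤s z≤n ∷ ct) , cong suc wt≡m) (comps-weight m)))
  (AllP.concat⁺ (AllP.map⁺ (All.map bumped (comps-weight m))))
  where
  bumped : ∀ {t} → IsComposition t × w t ≡ m → All (λ t → IsComposition t × w t ≡ suc m) (bump t)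
  bumped {[]}     _                = []
  bumped {c ∷ cs} (_ ∷ ccs , wt≡m) = ((s≤s z≤n ∷ ccs) , cong suc wt≡m) ∷ []

compsBelow : ℕ → List (List ℕ)
compsBelow zero    = []
compsBelow (suc n) = compsBelow n ++ comps n

compsBelow-weight : ∀ n → All (λ t → IsComposition t × w t < n) (compsBelow n)
compsBelow-weight zero    = []
compsBelow-weight (suc n) = AllP.++⁺
  (All.map (λ (ct , wt<n) → ct , ℕP.m<n⇒m<1+n wt<n) (compsBelow-weight n))
  (All.map (λ (ct , wt≡n) → ct , subst (_< suc n) (sym wt≡n) ℕP.≤-refl) (comps-weight n))

∑-compsBelow-+ : ∀ k d G → (∀ c → IsComposition c → k ≤ w c → G c ≡ 0ℚ) →
                 ∑ (compsBelow (k ℕ.+ d)) G ≡ ∑ (compsBelow k) G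
∑-compsBelow-+ k zero    G G≡0 = cong (λ n → ∑ (compsBelow n) G) (ℕP.+-identityʳ k)
∑-compsBelow-+ k (suc d) G G≡0 rewrite ℕP.+-suc k d = begin
  ∑ (compsBelow (k ℕ.+ d) ++ comps (k ℕ.+ d)) G         ≡⟨ ∑-++ (compsBelow (k ℕ.+ d)) _ G ⟩
  ∑ (compsBelow (k ℕ.+ d)) G + ∑ (comps (k ℕ.+ d)) G    ≡⟨ cong₂ _+_ (∑-compsBelow-+ k d G G≡0) top-layer ⟩
  ∑ (compsBelow k) G + 0ℚ                               ≡⟨ ℚP.+-identityʳ _ ⟩
  ∑ (compsBelow k) G                                    ∎
  where
  open ≡-Reasoning
  top-layer : ∑ (comps (k ℕ.+ d)) G ≡ 0ℚ
  top-layer = ∑-zeroᴬ G (comps-weight (k ℕ.+ d))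
    (λ {c} (cc , wc≡k+d) → G≡0 c cc (subst (k ≤_) (sym wc≡k+d) (ℕP.m≤m+n k d)))

∑-compsBelow-≤ : ∀ {k n} G → k ≤ n → (∀ c → IsComposition c → k ≤ w c → G c ≡ 0ℚ) →
                 ∑ (compsBelow n) G ≡ ∑ (compsBelow k) G
∑-compsBelow-≤ {k} G k≤n G≡0 =
  trans (cong (λ n → ∑ (compsBelow n) G) (sym (ℕP.m+[n∸m]≡n k≤n))) (∑-compsBelow-+ k _ G G≡0)

Hₚ₋₁ : ℕ → List ℕ → ℚ
Hₚ₋₁ p = H (p ℕ.∸ 1)

truncated : (List ℕ → ℚ) → ℕ → ℕ → ℚ
truncated α p n = ∑[ t ← compsBelow n ] (α t * p ^ℚ w t * Hₚ₋₁ p t)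

truncSum≡truncated : ∀ α p n → truncSum α p n ≡ truncated α p n
truncSum≡truncated α p zero    = refl
truncSum≡truncated α p (suc n) = begin
  truncSum α p n + sumℚ (map (λ c → α c * p ^ℚ n * Hₚ₋₁ p c) (comps n))
    ≡⟨ cong (_+ ∑[ c ← comps n ] (α c * p ^ℚ n * Hₚ₋₁ p c)) (truncSum≡truncated α p n) ⟩
  truncated α p n + ∑[ c ← comps n ] (α c * p ^ℚ n * Hₚ₋₁ p c)
    ≡⟨ cong (truncated α p n +_) (∑-congᴬ (comps-weight n) λ {c} (_ , wc≡n) → cong (λ k → α c * p ^ℚ k * Hₚ₋₁ p c) (sym wc≡n)) ⟩
  truncated α p n + ∑[ c ← comps n ] (α c * p ^ℚ w c * Hₚ₋₁ p c)
    ≡⟨ ∑-++ (compsBelow n) (comps n) _ ⟨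
  truncated α p (suc n) ∎
  where open ≡-Reasoning

indicator : {A : Set} → Dec A → ℚ
indicator (yes _) = 1ℚ
indicator (no _)  = 0ℚ

indicator-yes : ∀ {A : Set} → A → (d : Dec A) → indicator d ≡ 1ℚ
indicator-yes a (yes _) = refl
indicator-yes a (no ¬a) = ⊥-elim (¬a a)

indicator-no : ∀ {A : Set} → ¬ A → (d : Dec A) → indicator d ≡ 0ℚ
indicator-no ¬a (yes a) = ⊥-elim (¬a a)
indicator-no ¬a (no _)  = refl

indicator-⇔ : ∀ {A B : Set} → (A → B) → (B → A) → (d : Dec A) (e : Dec B) → indicator d ≡ indicator e
indicator-⇔ f g (yes a) e = sym (indicator-yes (f a) e)
indicator-⇔ f g (no ¬a) e = sym (indicator-no (¬a ∘ g) e)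

δ : List ℕ → List ℕ → ℚ
δ u t = indicator (LP.≡-dec ℕP._≟_ u t)

δ-≢ : ∀ u t → u ≢ t → δ u t ≡ 0ℚ
δ-≢ u t u≢t = indicator-no u≢t (LP.≡-dec ℕP._≟_ u t)

δ-injective : ∀ (g : List ℕ → List ℕ) → (∀ {u t} → g u ≡ g t → u ≡ t) → ∀ u t → δ (g u) (g t) ≡ δ u t
δ-injective g g-injective u t = indicator-⇔ g-injective (cong g) (LP.≡-dec ℕP._≟_ (g u) (g t)) (LP.≡-dec ℕP._≟_ u t)

δ-* : ∀ u t (f : List ℕ → ℚ) → δ u t * f t ≡ δ u t * f u
δ-* u t f with LP.≡-dec ℕP._≟_ u t
... | yes refl = refl
... | no _     = trans (ℚP.*-zeroˡ (f t)) (sym (ℚP.*-zeroˡ (f u)))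

incrHead : List ℕ → List ℕ
incrHead []       = []
incrHead (c ∷ cs) = suc c ∷ cs

incrHead-injective : ∀ {u t} → incrHead u ≡ incrHead t → u ≡ t
incrHead-injective {[]}    {[]}    _    = refl
incrHead-injective {_ ∷ _} {_ ∷ _} refl = refl

count-comps : ∀ m u → IsComposition u → ∑ (comps m) (δ u) ≡ indicator (w u ℕ.≟ m)
count-comps zero [] _ = refl
count-comps zero (x ∷ u) (1≤x ∷ _) =
  trans (ℚP.+-identityʳ _) (trans (δ-≢ (x ∷ u) [] (λ ())) (sym (indicator-no wu≢0 (w (x ∷ u) ℕ.≟ 0))))
  where
  wu≢0 : w (x ∷ u) ≢ 0
  wu≢0 wu≡0 = ℕP.<⇒≢ (ℕP.≤-trans 1≤x (ℕP.m≤m+n x (w u))) (sym wu≡0)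
count-comps (suc m) u cu = begin
  ∑ (map (1 ∷_) (comps m) ++ concatMap bump (comps m)) (δ u)
    ≡⟨ ∑-++ (map (1 ∷_) (comps m)) _ (δ u) ⟩
  ∑ (map (1 ∷_) (comps m)) (δ u) + ∑ (concatMap bump (comps m)) (δ u)
    ≡⟨ cong₂ _+_ (∑-map (1 ∷_) (comps m) (δ u)) (∑-concatMap bump (comps m) (δ u)) ⟩
  ∑[ t ← comps m ] δ u (1 ∷ t) + ∑[ t ← comps m ] ∑ (bump t) (δ u)
    ≡⟨ split u cu ⟩
  indicator (w u ℕ.≟ suc m) ∎
  where
  open ≡-Reasoning
  shift : ∀ k → indicator (k ℕ.≟ m) ≡ indicator (suc k ℕ.≟ suc m)
  shift k = indicator-⇔ (cong suc) ℕP.suc-injective (k ℕ.≟ m) (suc k ℕ.≟ suc m)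
  split : ∀ u → IsComposition u →
    ∑[ t ← comps m ] δ u (1 ∷ t) + ∑[ t ← comps m ] ∑ (bump t) (δ u) ≡ indicator (w u ℕ.≟ suc m)
  split [] _ = trans (cong₂ _+_ (∑-zero (comps m) (λ t → δ-≢ [] (1 ∷ t) (λ ()))) (∑-zero (comps m) no-bump)) (ℚP.+-identityʳ 0ℚ)
    where
    no-bump : ∀ t → ∑ (bump t) (δ []) ≡ 0ℚ
    no-bump []      = refl
    no-bump (c ∷ cs) = trans (ℚP.+-identityʳ _) (δ-≢ [] (suc c ∷ cs) (λ ()))
  split (1 ∷ u) (_ ∷ cu) = begin
    ∑[ t ← comps m ] δ (1 ∷ u) (1 ∷ t) + ∑[ t ← comps m ] ∑ (bump t) (δ (1 ∷ u))
      ≡⟨ cong₂ _+_ (∑-cong (comps m) (δ-injective (1 ∷_) LP.∷-injectiveʳ u))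
                   (∑-zeroᴬ _ (comps-weight m) (λ (ct , _) → no-bump _ ct)) ⟩
    ∑ (comps m) (δ u) + 0ℚ
      ≡⟨ trans (ℚP.+-identityʳ _) (count-comps m u cu) ⟩
    indicator (w u ℕ.≟ m)
      ≡⟨ shift (w u) ⟩
    indicator (w (1 ∷ u) ℕ.≟ suc m) ∎
    where
    no-bump : ∀ t → IsComposition t → ∑ (bump t) (δ (1 ∷ u)) ≡ 0ℚ
    no-bump []       _              = refl
    no-bump (c ∷ cs) (s≤s z≤n ∷ _) = trans (ℚP.+-identityʳ _) (δ-≢ (1 ∷ u) (suc c ∷ cs) (λ ()))
  split (suc (suc c) ∷ u) (_ ∷ cu) = begin
    ∑[ t ← comps m ] δ (2 ℕ.+ c ∷ u) (1 ∷ t) + ∑[ t ← comps m ] ∑ (bump t) (δ (2 ℕ.+ c ∷ u))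
      ≡⟨ cong₂ _+_ (∑-zero (comps m) (λ t → δ-≢ (2 ℕ.+ c ∷ u) (1 ∷ t) (λ ()))) (∑-cong (comps m) bumped) ⟩
    0ℚ + ∑ (comps m) (δ (suc c ∷ u))
      ≡⟨ trans (ℚP.+-identityˡ _) (count-comps m (suc c ∷ u) (s≤s z≤n ∷ cu)) ⟩
    indicator (w (suc c ∷ u) ℕ.≟ m)
      ≡⟨ shift (w (suc c ∷ u)) ⟩
    indicator (w (2 ℕ.+ c ∷ u) ℕ.≟ suc m) ∎
    where
    bumped : ∀ t → ∑ (bump t) (δ (2 ℕ.+ c ∷ u)) ≡ δ (suc c ∷ u) t
    bumped []       = sym (δ-≢ (suc c ∷ u) [] (λ ()))
    bumped (c′ ∷ cs) = trans (ℚP.+-identityʳ _) (δ-injective incrHead incrHead-injective (suc c ∷ u) (c′ ∷ cs))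

indicator-<-suc : ∀ k n → indicator (k ℕ.<? n) + indicator (k ℕ.≟ n) ≡ indicator (k ℕ.<? suc n)
indicator-<-suc k n with k ℕ.<? n | k ℕ.≟ n
... | yes k<n | yes refl = ⊥-elim (ℕP.<-irrefl refl k<n)
... | yes k<n | no _     = trans (ℚP.+-identityʳ 1ℚ) (sym (indicator-yes (ℕP.m<n⇒m<1+n k<n) (k ℕ.<? suc n)))
... | no _    | yes refl = sym (indicator-yes ℕP.≤-refl (k ℕ.<? suc k))
... | no k≮n  | no k≢n   = sym (indicator-no k≮1+n (k ℕ.<? suc n))
  where
  k≮1+n : ¬ k < suc n
  k≮1+n k<1+n with ℕP.m≤n⇒m<n∨m≡n (ℕP.≤-pred k<1+n)
  ... | inj₁ k<n = k≮n k<n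
  ... | inj₂ k≡n = k≢n k≡n

count-compsBelow : ∀ n u → IsComposition u → ∑ (compsBelow n) (δ u) ≡ indicator (w u ℕ.<? n)
count-compsBelow zero    u cu = sym (indicator-no (λ ()) (w u ℕ.<? 0))
count-compsBelow (suc n) u cu = begin
  ∑ (compsBelow n ++ comps n) (δ u)                   ≡⟨ ∑-++ (compsBelow n) (comps n) (δ u) ⟩
  ∑ (compsBelow n) (δ u) + ∑ (comps n) (δ u)          ≡⟨ cong₂ _+_ (count-compsBelow n u cu) (count-comps n u cu) ⟩
  indicator (w u ℕ.<? n) + indicator (w u ℕ.≟ n)      ≡⟨ indicator-<-suc (w u) n ⟩
  indicator (w u ℕ.<? suc n)                          ∎
  where open ≡-Reasoning

∑-compsBelow-δ : ∀ n u f → IsComposition u → ∑[ t ← compsBelow n ] (δ u t * f t) ≡ indicator (w u ℕ.<? n) * f u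
∑-compsBelow-δ n u f cu = begin
  ∑[ t ← compsBelow n ] (δ u t * f t)    ≡⟨ ∑-cong (compsBelow n) (λ t → δ-* u t f) ⟩
  ∑[ t ← compsBelow n ] (δ u t * f u)    ≡⟨ ∑-*ʳ (compsBelow n) (f u) (δ u) ⟨
  ∑ (compsBelow n) (δ u) * f u           ≡⟨ cong (_* f u) (count-compsBelow n u cu) ⟩
  indicator (w u ℕ.<? n) * f u           ∎
  where open ≡-Reasoning

Representable : (ℕ → ℚ) → Set
Representable a = Σ (List ℕ → ℚ) λ α → ∀ n → Σ ℕ λ P →
  ∀ p → ⦃ _ : Prime p ⦄ → P ≤ p → a p ≡ truncated α p n [mod p ^ n ]

denominatorBound : (List ℕ → ℚ) → ℕ → ℕ
denominatorBound α n = suc (sum (map (ℚ.↧ₙ_ ∘ α) (compsBelow n)))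

module _ {p : ℕ} ⦃ p-prime : Prime p ⦄ where

  integral-↧ₙ< : ∀ {x} → ℚ.↧ₙ x < p → Integral p x
  integral-↧ₙ< ↧x<p = integral (p∤-nonzero-< (s≤s z≤n) ↧x<p)

  integral-coefficients : ∀ α n → denominatorBound α n ≤ p → All (λ t → Integral p (α t)) (compsBelow n)
  integral-coefficients α n = go (compsBelow n)
    where
    go : ∀ ts → suc (sum (map (ℚ.↧ₙ_ ∘ α) ts)) ≤ p → All (λ t → Integral p (α t)) ts
    go []       _ = []
    go (t ∷ ts) l = integral-↧ₙ< (ℕP.<-≤-trans (s≤s (ℕP.m≤m+n _ _)) l)
                  ∷ go ts (ℕP.≤-trans (s≤s (ℕP.m≤n+m _ (ℚ.↧ₙ α t))) l)

  H-integral : ∀ t N → N < p → Integral p (H N t)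
  H-integral []       N N<p = integral-1
  H-integral (s ∷ ss) N N<p = sumTo-integral N _ λ j j<N →
    integral-* (integral-inv-pow j s (p∤-nonzero-< (s≤s z≤n) (ℕP.≤-<-trans j<N N<p)))
               (H-integral ss j (ℕP.<-trans j<N N<p))

  p∸1<p : p ℕ.∸ 1 < p
  p∸1<p = ℕP.∸-monoʳ-< {p} {1} {0} (s≤s z≤n) (ℕ.>-nonZero⁻¹ p {{prime⇒nonZero p-prime}})

  Hₚ₋₁-integral : ∀ t → Integral p (Hₚ₋₁ p t)
  Hₚ₋₁-integral t = H-integral t (p ℕ.∸ 1) p∸1<p

  truncated-integral : ∀ α n → All (λ t → Integral p (α t)) (compsBelow n) → Integral p (truncated α p n)
  truncated-integral α n iα = ∑-integral _ iα λ {t} iαt →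
    integral-* (integral-* iαt (integral-^ℚ (w t))) (Hₚ₋₁-integral t)

truncated-+ : ∀ α β p n → truncated (λ t → α t + β t) p n ≡ truncated α p n + truncated β p n
truncated-+ α β p n = trans (∑-cong (compsBelow n) distrib) (∑-+ (compsBelow n) _ _)
  where
  open ℚSolver.+-*-Solver
  distrib : ∀ t → (α t + β t) * p ^ℚ w t * Hₚ₋₁ p t ≡ α t * p ^ℚ w t * Hₚ₋₁ p t + β t * p ^ℚ w t * Hₚ₋₁ p t
  distrib t = solve 4 (λ a b c d → (a :+ b) :* c :* d := a :* c :* d :+ b :* c :* d) refl (α t) (β t) (p ^ℚ w t) (Hₚ₋₁ p t)

representable-cong : ∀ {a b} → (∀ p → Prime p → a p ≡ b p) → Representable a → Representable b
representable-cong a≡b (α , a≡α) = α , λ n → let (P , a≡) = a≡α n in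
  P , λ p ⦃ p-prime ⦄ P≤p → ≡mod-trans (≡⇒≡mod (sym (a≡b p p-prime))) (a≡ p P≤p)

representable-+ : ∀ {a b} → Representable a → Representable b → Representable (λ p → a p + b p)
representable-+ (α , a≡α) (β , b≡β) = (λ t → α t + β t) , λ n →
  let (Pa , a≡) = a≡α n ; (Pb , b≡) = b≡β n in
  Pa ⊔ Pb , λ p P≤p → ≡mod-trans
    (≡mod-+ (a≡ p (ℕP.m⊔n≤o⇒m≤o Pa Pb P≤p)) (b≡ p (ℕP.m⊔n≤o⇒n≤o Pa Pb P≤p)))
    (≡⇒≡mod (sym (truncated-+ α β p n)))

representable-0 : Representable (λ _ → 0ℚ)
representable-0 = (λ _ → 0ℚ) , λ n → 0 , λ p _ → ≡⇒≡mod (sym (∑-zero (compsBelow n) λ t →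
  trans (cong (_* Hₚ₋₁ p t) (ℚP.*-zeroˡ (p ^ℚ w t))) (ℚP.*-zeroˡ (Hₚ₋₁ p t))))

representable-∑ : ∀ {X : Set} (xs : List X) (f : X → ℕ → ℚ) →
                  All (λ x → Representable (f x)) xs → Representable (λ p → ∑[ x ← xs ] f x p)
representable-∑ []       f []           = representable-0
representable-∑ (x ∷ xs) f (fx ∷ fxs) = representable-+ fx (representable-∑ xs f fxs)

representable-const : ∀ c → Representable (λ _ → c)
representable-const c = (λ t → δ [] t * c) , λ where
    zero    → suc (ℚ.↧ₙ c) , λ p ↧c<p → ≡mod-^0 (integral-↧ₙ< ↧c<p) integral-0
    (suc n) → 0 , λ p _ → ≡⇒≡mod (sym (truncated-δ p n))
  where
  truncated-δ : ∀ p n → truncated (λ t → δ [] t * c) p (suc n) ≡ c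
  truncated-δ p n = begin
    ∑[ t ← compsBelow (suc n) ] (δ [] t * c * p ^ℚ w t * Hₚ₋₁ p t)
      ≡⟨ ∑-cong (compsBelow (suc n)) (λ t → trans (ℚP.*-assoc (δ [] t * c) _ _) (ℚP.*-assoc (δ [] t) c _)) ⟩
    ∑[ t ← compsBelow (suc n) ] (δ [] t * (c * (p ^ℚ w t * Hₚ₋₁ p t)))
      ≡⟨ ∑-compsBelow-δ (suc n) [] (λ t → c * (p ^ℚ w t * Hₚ₋₁ p t)) [] ⟩
    1ℚ * (c * (1ℚ * 1ℚ))
      ≡⟨ trans (ℚP.*-identityˡ _) (ℚP.*-identityʳ c) ⟩
    c ∎
    where open ≡-Reasoning

-- Convolution of coefficient families

CompositionOp : Set
CompositionOp = List ℕ → List ℕ → List (List ℕ)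

WeightAdditive : CompositionOp → Set
WeightAdditive op = ∀ c d → IsComposition c → IsComposition d →
  All (λ u → IsComposition u × w u ≡ w c ℕ.+ w d) (op c d)

convolve : CompositionOp → (List ℕ → ℚ) → (List ℕ → ℚ) → List ℕ → ℚ
convolve op α β t =
  ∑[ c ← compsBelow (suc (w t)) ] ∑[ d ← compsBelow (suc (w t)) ] (α c * β d * ∑[ u ← op c d ] δ u t)

module Convolution (op : CompositionOp) (op-additive : WeightAdditive op) (α β : List ℕ → ℚ) where

  private
    multiplicity : List ℕ → List ℕ → List ℕ → ℚ
    multiplicity c d t = ∑[ u ← op c d ] δ u t

    term : List ℕ → List ℕ → List ℕ → ℚ
    term c d t = α c * β d * multiplicity c d t

    term-≢ : ∀ c d t → IsComposition c → IsComposition d → w c ℕ.+ w d ≢ w t → term c d t ≡ 0ℚ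
    term-≢ c d t cc cd wcd≢wt = trans (cong (α c * β d *_) multiplicity≡0) (ℚP.*-zeroʳ (α c * β d))
      where
      multiplicity≡0 : multiplicity c d t ≡ 0ℚ
      multiplicity≡0 = ∑-zeroᴬ (λ u → δ u t) (op-additive c d cc cd)
        (λ {u} (_ , wu≡) → δ-≢ u t (λ u≡t → wcd≢wt (trans (sym wu≡) (cong w u≡t))))

  convolve-compsBelow : ∀ n t → w t < n →
    convolve op α β t ≡ ∑[ c ← compsBelow n ] ∑[ d ← compsBelow n ] term c d t
  convolve-compsBelow n t wt<n = sym (begin
    ∑[ c ← compsBelow n ] ∑[ d ← compsBelow n ] term c d t
      ≡⟨ ∑-compsBelow-≤ _ wt<n (λ c cc k≤wc → ∑-zeroᴬ _ (compsBelow-weight n) λ {d} (cd , _) →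
           term-≢ c d t cc cd (λ eq → ℕP.<⇒≢ (ℕP.≤-trans k≤wc (ℕP.m≤m+n (w c) (w d))) (sym eq))) ⟩
    ∑[ c ← compsBelow k ] ∑[ d ← compsBelow n ] term c d t
      ≡⟨ ∑-congᴬ (compsBelow-weight k) (λ {c} (cc , _) → ∑-compsBelow-≤ _ wt<n λ d cd k≤wd →
           term-≢ c d t cc cd (λ eq → ℕP.<⇒≢ (ℕP.≤-trans k≤wd (ℕP.m≤n+m (w d) (w c))) (sym eq))) ⟩
    ∑[ c ← compsBelow k ] ∑[ d ← compsBelow k ] term c d t ∎)
    where
    open ≡-Reasoning
    k = suc (w t)

  private
    ∑-term : ∀ n (φ : List ℕ → ℚ) c d → IsComposition c → IsComposition d →
      ∑[ t ← compsBelow n ] (term c d t * φ t) ≡ α c * β d * ∑[ u ← op c d ] (indicator (w u ℕ.<? n) * φ u)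
    ∑-term n φ c d cc cd = begin
      ∑[ t ← C ] (α c * β d * multiplicity c d t * φ t)
        ≡⟨ ∑-cong C (λ t → ℚP.*-assoc (α c * β d) (multiplicity c d t) (φ t)) ⟩
      ∑[ t ← C ] (α c * β d * (multiplicity c d t * φ t))
        ≡⟨ ∑-*ˡ C (α c * β d) _ ⟨
      α c * β d * ∑[ t ← C ] (multiplicity c d t * φ t)
        ≡⟨ cong (α c * β d *_) (∑-cong C (λ t → ∑-*ʳ (op c d) (φ t) (λ u → δ u t))) ⟩
      α c * β d * ∑[ t ← C ] ∑[ u ← op c d ] (δ u t * φ t)
        ≡⟨ cong (α c * β d *_) (∑-comm C (op c d) (λ t u → δ u t * φ t)) ⟩
      α c * β d * ∑[ u ← op c d ] ∑[ t ← C ] (δ u t * φ t)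
        ≡⟨ cong (α c * β d *_) (∑-congᴬ (op-additive c d cc cd) (λ {u} (cu , _) → ∑-compsBelow-δ n u φ cu)) ⟩
      α c * β d * ∑[ u ← op c d ] (indicator (w u ℕ.<? n) * φ u) ∎
      where
      open ≡-Reasoning
      C = compsBelow n

  ∑-convolve : ∀ n (φ : List ℕ → ℚ) → ∑[ t ← compsBelow n ] (convolve op α β t * φ t) ≡
    ∑[ c ← compsBelow n ] ∑[ d ← compsBelow n ] (α c * β d * ∑[ u ← op c d ] (indicator (w u ℕ.<? n) * φ u))
  ∑-convolve n φ = begin
    ∑[ t ← C ] (convolve op α β t * φ t)
      ≡⟨ ∑-congᴬ (compsBelow-weight n) (λ {t} (_ , wt<n) → cong (_* φ t) (convolve-compsBelow n t wt<n)) ⟩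
    ∑[ t ← C ] (∑[ c ← C ] ∑[ d ← C ] term c d t * φ t)
      ≡⟨ ∑-cong C (λ t → trans (∑-*ʳ C (φ t) _) (∑-cong C (λ c → ∑-*ʳ C (φ t) _))) ⟩
    ∑[ t ← C ] ∑[ c ← C ] ∑[ d ← C ] (term c d t * φ t)
      ≡⟨ ∑-comm C C _ ⟩
    ∑[ c ← C ] ∑[ t ← C ] ∑[ d ← C ] (term c d t * φ t)
      ≡⟨ ∑-cong C (λ c → ∑-comm C C _) ⟩
    ∑[ c ← C ] ∑[ d ← C ] ∑[ t ← C ] (term c d t * φ t)
      ≡⟨ ∑-congᴬ (compsBelow-weight n) (λ {c} (cc , _) →
           ∑-congᴬ (compsBelow-weight n) (λ {d} (cd , _) → ∑-term n φ c d cc cd)) ⟩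
    ∑[ c ← C ] ∑[ d ← C ] (α c * β d * ∑[ u ← op c d ] (indicator (w u ℕ.<? n) * φ u)) ∎
    where
    open ≡-Reasoning
    C = compsBelow n

  module _ {p : ℕ} ⦃ p-prime : Prime p ⦄ where

    -- The cut-off at weight n is invisible modulo p ^ n because of the factor p ^ w u.
    ∑-convolve-≡mod : ∀ n (ψ : List ℕ → ℚ) → (∀ u → IsComposition u → Integral p (ψ u)) →
      All (λ c → Integral p (α c)) (compsBelow n) → All (λ d → Integral p (β d)) (compsBelow n) →
      ∑[ t ← compsBelow n ] (convolve op α β t * (p ^ℚ w t * ψ t)) ≡
      ∑[ c ← compsBelow n ] ∑[ d ← compsBelow n ] (α c * β d * ∑[ u ← op c d ] (p ^ℚ w u * ψ u)) [mod p ^ n ]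
    ∑-convolve-≡mod n ψ iψ iα iβ = ≡mod-trans (≡⇒≡mod (∑-convolve n φ))
      (∑-≡mod _ _ (All.zip (compsBelow-weight n , iα)) λ {c} ((cc , _) , iαc) →
        ∑-≡mod _ _ (All.zip (compsBelow-weight n , iβ)) λ {d} ((cd , _) , iβd) →
          ≡mod-*ˡ (α c * β d) (integral-* iαc iβd)
            (∑-≡mod _ _ (op-additive c d cc cd) (λ {u} (cu , _) → drop-indicator u cu)))
      where
      φ : List ℕ → ℚ
      φ u = p ^ℚ w u * ψ u
      drop-indicator : ∀ u → IsComposition u → indicator (w u ℕ.<? n) * φ u ≡ φ u [mod p ^ n ]
      drop-indicator u cu with w u ℕ.<? n
      ... | yes _    = ≡⇒≡mod (ℚP.*-identityˡ (φ u))
      ... | no wu≮n  = ≡mod-trans (≡⇒≡mod (ℚP.*-zeroˡ (φ u)))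
                         (≡mod-sym (^ℚ-*-≡mod-0 (w u) (ψ u) (ℕP.≮⇒≥ wu≮n) (iψ u cu)))

-- The stuffle product

stuffle : List ℕ → List ℕ → List (List ℕ)
stuffle []      d       = d ∷ []
stuffle (x ∷ a) []      = (x ∷ a) ∷ []
stuffle (x ∷ a) (y ∷ b) =
  map (x ∷_) (stuffle a (y ∷ b)) ++ (map (y ∷_) (stuffle (x ∷ a) b) ++ map ((x ℕ.+ y) ∷_) (stuffle a b))

stuffle-additive : WeightAdditive stuffle
stuffle-additive []      d       _ cd = (cd , refl) ∷ []
stuffle-additive (x ∷ a) []      cc _ = (cc , sym (ℕP.+-identityʳ _)) ∷ []
stuffle-additive (x ∷ a) (y ∷ b) (1≤x ∷ ca) (1≤y ∷ cb) = AllP.++⁺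
  (AllP.map⁺ (All.map (λ (cu , wu≡) → (1≤x ∷ cu) , trans (cong (x ℕ.+_) wu≡) (sym (ℕP.+-assoc x (w a) _)))
                      (stuffle-additive a (y ∷ b) ca (1≤y ∷ cb))))
  (AllP.++⁺
    (AllP.map⁺ (All.map (λ (cu , wu≡) → (1≤y ∷ cu) , trans (cong (y ℕ.+_) wu≡) (middle (w a) (w b)))
                        (stuffle-additive (x ∷ a) b (1≤x ∷ ca) cb)))
    (AllP.map⁺ (All.map (λ (cu , wu≡) → (ℕP.≤-trans 1≤x (ℕP.m≤m+n x y) ∷ cu) , trans (cong ((x ℕ.+ y) ℕ.+_) wu≡) (merged (w a) (w b)))
                        (stuffle-additive a b ca cb))))
  where
  open ℕSolver.+-*-Solver
  middle : ∀ A B → y ℕ.+ (x ℕ.+ A ℕ.+ B) ≡ x ℕ.+ A ℕ.+ (y ℕ.+ B)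
  middle A B = solve 4 (λ x y A B → y :+ (x :+ A :+ B) := x :+ A :+ (y :+ B)) refl x y A B
  merged : ∀ A B → x ℕ.+ y ℕ.+ (A ℕ.+ B) ≡ x ℕ.+ A ℕ.+ (y ℕ.+ B)
  merged A B = solve 4 (λ x y A B → x :+ y :+ (A :+ B) := x :+ A :+ (y :+ B)) refl x y A B

∑-stuffle-∷ : ∀ x y a b f → ∑ (stuffle (x ∷ a) (y ∷ b)) f ≡
  ∑[ u ← stuffle a (y ∷ b) ] f (x ∷ u) + (∑[ u ← stuffle (x ∷ a) b ] f (y ∷ u) + ∑[ u ← stuffle a b ] f (x ℕ.+ y ∷ u))
∑-stuffle-∷ x y a b f = begin
  ∑ (map (x ∷_) A₁ ++ (map (y ∷_) A₂ ++ map ((x ℕ.+ y) ∷_) A₃)) f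
    ≡⟨ ∑-++ (map (x ∷_) A₁) _ f ⟩
  ∑ (map (x ∷_) A₁) f + ∑ (map (y ∷_) A₂ ++ map ((x ℕ.+ y) ∷_) A₃) f
    ≡⟨ cong (∑ (map (x ∷_) A₁) f +_) (∑-++ (map (y ∷_) A₂) _ f) ⟩
  ∑ (map (x ∷_) A₁) f + (∑ (map (y ∷_) A₂) f + ∑ (map ((x ℕ.+ y) ∷_) A₃) f)
    ≡⟨ cong₂ _+_ (∑-map (x ∷_) A₁ f) (cong₂ _+_ (∑-map (y ∷_) A₂ f) (∑-map ((x ℕ.+ y) ∷_) A₃ f)) ⟩
  ∑[ u ← A₁ ] f (x ∷ u) + (∑[ u ← A₂ ] f (y ∷ u) + ∑[ u ← A₃ ] f (x ℕ.+ y ∷ u)) ∎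
  where
  open ≡-Reasoning
  A₁ = stuffle a (y ∷ b)
  A₂ = stuffle (x ∷ a) b
  A₃ = stuffle a b

∑-H-suc-∷ : ∀ N z L → ∑[ u ← L ] H (suc N) (z ∷ u) ≡ ∑[ u ← L ] H N (z ∷ u) + inv-pow N z * ∑ L (H N)
∑-H-suc-∷ N z L = trans (∑-+ L (λ u → H N (z ∷ u)) (λ u → inv-pow N z * H N u))
  (cong (∑[ u ← L ] H N (z ∷ u) +_) (sym (∑-*ˡ L (inv-pow N z) (H N))))

H-stuffle : ∀ N c d → H N c * H N d ≡ ∑ (stuffle c d) (H N)
H-stuffle N []      d  = trans (ℚP.*-identityˡ (H N d)) (sym (ℚP.+-identityʳ (H N d)))
H-stuffle N (x ∷ a) [] = trans (ℚP.*-identityʳ (H N (x ∷ a))) (sym (ℚP.+-identityʳ (H N (x ∷ a))))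
H-stuffle zero (x ∷ a) (y ∷ b) = sym (trans (∑-stuffle-∷ x y a b (H 0))
  (trans (cong₂ _+_ (∑-0 (stuffle a (y ∷ b))) (cong₂ _+_ (∑-0 (stuffle (x ∷ a) b)) (∑-0 (stuffle a b)))) refl))
H-stuffle (suc N) (x ∷ a) (y ∷ b) = begin
  (A + fx * Ha) * (B + fy * Hb)
    ≡⟨ solve 6 (λ A B Ha Hb fx fy → (A :+ fx :* Ha) :* (B :+ fy :* Hb) :=
                  A :* B :+ (fx :* (Ha :* B) :+ (fy :* (A :* Hb) :+ fx :* fy :* (Ha :* Hb)))) refl A B Ha Hb fx fy ⟩
  A * B + (fx * (Ha * B) + (fy * (A * Hb) + fx * fy * (Ha * Hb)))
    ≡⟨ cong₂ (λ u v → u + (fx * (Ha * B) + (fy * (A * Hb) + v))) A*B (cong₂ _*_ (inv-pow-+ N x y) (H-stuffle N a b)) ⟩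
  (T₁ + (T₂ + T₃)) + (fx * (Ha * B) + (fy * (A * Hb) + fxy * ∑ A₃ (H N)))
    ≡⟨ cong₂ (λ u v → (T₁ + (T₂ + T₃)) + (fx * u + (fy * v + fxy * ∑ A₃ (H N)))) (H-stuffle N a (y ∷ b)) (H-stuffle N (x ∷ a) b) ⟩
  (T₁ + (T₂ + T₃)) + (fx * ∑ A₁ (H N) + (fy * ∑ A₂ (H N) + fxy * ∑ A₃ (H N)))
    ≡⟨ solve 9 (λ T₁ T₂ T₃ fx S₁ fy S₂ fxy S₃ → (T₁ :+ (T₂ :+ T₃)) :+ (fx :* S₁ :+ (fy :* S₂ :+ fxy :* S₃)) :=
                  (T₁ :+ fx :* S₁) :+ ((T₂ :+ fy :* S₂) :+ (T₃ :+ fxy :* S₃)))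
               refl T₁ T₂ T₃ fx (∑ A₁ (H N)) fy (∑ A₂ (H N)) fxy (∑ A₃ (H N)) ⟩
  (T₁ + fx * ∑ A₁ (H N)) + ((T₂ + fy * ∑ A₂ (H N)) + (T₃ + fxy * ∑ A₃ (H N)))
    ≡⟨ sym (cong₂ _+_ (∑-H-suc-∷ N x A₁) (cong₂ _+_ (∑-H-suc-∷ N y A₂) (∑-H-suc-∷ N (x ℕ.+ y) A₃))) ⟩
  ∑[ u ← A₁ ] H (suc N) (x ∷ u) + (∑[ u ← A₂ ] H (suc N) (y ∷ u) + ∑[ u ← A₃ ] H (suc N) (x ℕ.+ y ∷ u))
    ≡⟨ ∑-stuffle-∷ x y a b (H (suc N)) ⟨
  ∑ (stuffle (x ∷ a) (y ∷ b)) (H (suc N)) ∎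
  where
  open ≡-Reasoning
  open ℚSolver.+-*-Solver
  A = H N (x ∷ a)
  B = H N (y ∷ b)
  Ha = H N a
  Hb = H N b
  fx = inv-pow N x
  fy = inv-pow N y
  fxy = inv-pow N (x ℕ.+ y)
  A₁ = stuffle a (y ∷ b)
  A₂ = stuffle (x ∷ a) b
  A₃ = stuffle a b
  T₁ = ∑[ u ← A₁ ] H N (x ∷ u)
  T₂ = ∑[ u ← A₂ ] H N (y ∷ u)
  T₃ = ∑[ u ← A₃ ] H N (x ℕ.+ y ∷ u)
  A*B : A * B ≡ T₁ + (T₂ + T₃)
  A*B = trans (H-stuffle N (x ∷ a) (y ∷ b)) (∑-stuffle-∷ x y a b (H N))

truncated-* : ∀ α β p n → truncated α p n * truncated β p n ≡
  ∑[ c ← compsBelow n ] ∑[ d ← compsBelow n ] (α c * β d * ∑[ u ← stuffle c d ] (p ^ℚ w u * Hₚ₋₁ p u))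
truncated-* α β p n = begin
  truncated α p n * truncated β p n
    ≡⟨ ∑-*-∑ C C _ _ ⟩
  ∑[ c ← C ] ∑[ d ← C ] (α c * p ^ℚ w c * Hₚ₋₁ p c * (β d * p ^ℚ w d * Hₚ₋₁ p d))
    ≡⟨ ∑-congᴬ (compsBelow-weight n) (λ {c} (cc , _) → ∑-congᴬ (compsBelow-weight n) (λ {d} (cd , _) → regroup c d cc cd)) ⟩
  ∑[ c ← C ] ∑[ d ← C ] (α c * β d * ∑[ u ← stuffle c d ] (p ^ℚ w u * Hₚ₋₁ p u)) ∎
  where
  open ≡-Reasoning
  open ℚSolver.+-*-Solver
  C = compsBelow n
  regroup : ∀ c d → IsComposition c → IsComposition d →
    α c * p ^ℚ w c * Hₚ₋₁ p c * (β d * p ^ℚ w d * Hₚ₋₁ p d) ≡ α c * β d * ∑[ u ← stuffle c d ] (p ^ℚ w u * Hₚ₋₁ p u)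
  regroup c d cc cd = begin
    α c * p ^ℚ w c * Hₚ₋₁ p c * (β d * p ^ℚ w d * Hₚ₋₁ p d)
      ≡⟨ solve 6 (λ a x h b y k → a :* x :* h :* (b :* y :* k) := a :* b :* ((x :* y) :* (h :* k))) refl
                 (α c) (p ^ℚ w c) (Hₚ₋₁ p c) (β d) (p ^ℚ w d) (Hₚ₋₁ p d) ⟩
    α c * β d * (p ^ℚ w c * p ^ℚ w d * (Hₚ₋₁ p c * Hₚ₋₁ p d))
      ≡⟨ cong (λ z → α c * β d * (p ^ℚ w c * p ^ℚ w d * z)) (H-stuffle (p ℕ.∸ 1) c d) ⟩
    α c * β d * (p ^ℚ w c * p ^ℚ w d * ∑ (stuffle c d) (Hₚ₋₁ p))
      ≡⟨ cong (α c * β d *_) (∑-*ˡ (stuffle c d) (p ^ℚ w c * p ^ℚ w d) (Hₚ₋₁ p)) ⟩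
    α c * β d * ∑[ u ← stuffle c d ] (p ^ℚ w c * p ^ℚ w d * Hₚ₋₁ p u)
      ≡⟨ cong (α c * β d *_) (∑-congᴬ (stuffle-additive c d cc cd) λ {u} (_ , wu≡) →
           cong (_* Hₚ₋₁ p u) (trans (sym (^ℚ-+ p (w c) (w d))) (cong (p ^ℚ_) (sym wu≡)))) ⟩
    α c * β d * ∑[ u ← stuffle c d ] (p ^ℚ w u * Hₚ₋₁ p u) ∎

truncated-convolve-stuffle : ∀ α β {p} ⦃ _ : Prime p ⦄ n →
  All (λ c → Integral p (α c)) (compsBelow n) → All (λ d → Integral p (β d)) (compsBelow n) →
  truncated (convolve stuffle α β) p n ≡ truncated α p n * truncated β p n [mod p ^ n ]
truncated-convolve-stuffle α β {p} n iα iβ =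
  ≡mod-trans (≡⇒≡mod (∑-cong (compsBelow n) (λ t → ℚP.*-assoc (convolve stuffle α β t) (p ^ℚ w t) (Hₚ₋₁ p t))))
    (≡mod-trans (∑-convolve-≡mod n (Hₚ₋₁ p) (λ u _ → Hₚ₋₁-integral u) iα iβ)
                (≡⇒≡mod (sym (truncated-* α β p n))))
  where open Convolution stuffle stuffle-additive α β

representable-* : ∀ {a b} → Representable a → Representable b → Representable (λ p → a p * b p)
representable-* (α , a≡α) (β , b≡β) = convolve stuffle α β , λ n →
  let (Pa , a≡) = a≡α n ; (Pb , b≡) = b≡β n
      Bα = denominatorBound α n ; Bβ = denominatorBound β n in
  (Pa ⊔ Pb) ⊔ (Bα ⊔ Bβ) , λ p P≤p →
    let P≤p₁ = ℕP.m⊔n≤o⇒m≤o (Pa ⊔ Pb) _ P≤p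
        P≤p₂ = ℕP.m⊔n≤o⇒n≤o (Pa ⊔ Pb) _ P≤p
        iα = integral-coefficients α n (ℕP.m⊔n≤o⇒m≤o Bα Bβ P≤p₂)
        iβ = integral-coefficients β n (ℕP.m⊔n≤o⇒n≤o Bα Bβ P≤p₂)
        a≡ₚ = a≡ p (ℕP.m⊔n≤o⇒m≤o Pa Pb P≤p₁)
        b≡ₚ = b≡ p (ℕP.m⊔n≤o⇒n≤o Pa Pb P≤p₁)
    in ≡mod-trans (≡mod-* (≡mod-integral a≡ₚ (truncated-integral α n iα)) (truncated-integral β n iβ) a≡ₚ b≡ₚ)
                  (≡mod-sym (truncated-convolve-stuffle α β n iα iβ))

single : ℕ → List ℕ
single zero    = []
single (suc k) = suc k ∷ []

single-composition : ∀ m → IsComposition (single m) × w (single m) ≡ m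
single-composition zero    = [] , refl
single-composition (suc k) = (s≤s z≤n ∷ []) , ℕP.+-identityʳ (suc k)

-- A power series ∑ g m xᵐ is encoded by a coefficient family carried by the one-part
-- compositions; convolution along mergeOp is then the Cauchy product.
onSingles : (ℕ → ℚ) → List ℕ → ℚ
onSingles g []          = 0ℚ
onSingles g (x ∷ [])    = g x
onSingles g (_ ∷ _ ∷ _) = 0ℚ

∑-comps-onSingles : ∀ m g → ∑ (comps m) (onSingles g) ≡ onSingles g (single m)
∑-comps-onSingles zero    g = ℚP.+-identityˡ 0ℚ
∑-comps-onSingles (suc m) g = begin
  ∑ (map (1 ∷_) (comps m) ++ concatMap bump (comps m)) (onSingles g)
    ≡⟨ ∑-++ (map (1 ∷_) (comps m)) _ (onSingles g) ⟩
  ∑ (map (1 ∷_) (comps m)) (onSingles g) + ∑ (concatMap bump (comps m)) (onSingles g)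
    ≡⟨ cong₂ _+_ (∑-map (1 ∷_) (comps m) (onSingles g)) (∑-concatMap bump (comps m) (onSingles g)) ⟩
  ∑[ t ← comps m ] onSingles g (1 ∷ t) + ∑[ t ← comps m ] ∑ (bump t) (onSingles g)
    ≡⟨ cong (∑[ t ← comps m ] onSingles g (1 ∷ t) +_) (trans (∑-cong (comps m) bumped) (∑-comps-onSingles m (g ∘ suc))) ⟩
  ∑[ t ← comps m ] onSingles g (1 ∷ t) + onSingles (g ∘ suc) (single m)
    ≡⟨ leading-one m (comps-weight m) ⟩
  onSingles g (single (suc m)) ∎
  where
  open ≡-Reasoning
  bumped : ∀ t → ∑ (bump t) (onSingles g) ≡ onSingles (g ∘ suc) t
  bumped []          = refl
  bumped (_ ∷ [])    = ℚP.+-identityʳ _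
  bumped (_ ∷ _ ∷ _) = ℚP.+-identityʳ 0ℚ
  leading-one : ∀ m → All (λ t → IsComposition t × w t ≡ m) (comps m) →
    ∑[ t ← comps m ] onSingles g (1 ∷ t) + onSingles (g ∘ suc) (single m) ≡ onSingles g (single (suc m))
  leading-one zero    _  = trans (ℚP.+-identityʳ _) (ℚP.+-identityʳ _)
  leading-one (suc m) ts = trans (cong (_+ g (2 ℕ.+ m)) (∑-zeroᴬ _ ts λ { {[]} (_ , ()) ; {_ ∷ _} _ → refl }))
                                 (ℚP.+-identityˡ _)

∑-compsBelow-onSingles : ∀ n g → ∑ (compsBelow n) (onSingles g) ≡ sumTo n (λ m → onSingles g (single m))
∑-compsBelow-onSingles zero    g = refl
∑-compsBelow-onSingles (suc n) g = trans (∑-++ (compsBelow n) (comps n) (onSingles g))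
  (cong₂ _+_ (∑-compsBelow-onSingles n g) (∑-comps-onSingles n g))

mergeOp : CompositionOp
mergeOp c d = single (w c ℕ.+ w d) ∷ []

mergeOp-additive : WeightAdditive mergeOp
mergeOp-additive c d _ _ = single-composition (w c ℕ.+ w d) ∷ []

ratioPow : ℕ → ℕ → ℕ → ℚ
ratioPow p q m = p ^ℚ m * inv-pow q m

ratioPow-+ : ∀ p q a b → ratioPow p q a * ratioPow p q b ≡ ratioPow p q (a ℕ.+ b)
ratioPow-+ p q a b = trans
  (solve 4 (λ x y u v → (x :* u) :* (y :* v) := (x :* y) :* (u :* v)) refl (p ^ℚ a) (p ^ℚ b) (inv-pow q a) (inv-pow q b))
  (cong₂ _*_ (sym (^ℚ-+ p a b)) (inv-pow-+ q a b))
  where open ℚSolver.+-*-Solver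

integral-ratioPow : ∀ {p} ⦃ _ : Prime p ⦄ q m → ¬ p ∣ suc q → Integral p (ratioPow p q m)
integral-ratioPow q m p∤q+1 = integral-* (integral-^ℚ m) (integral-inv-pow q m p∤q+1)

∑-mergeOp-ratioPow : ∀ p q c d → ∑[ u ← mergeOp c d ] ratioPow p q (w u) ≡ ratioPow p q (w c) * ratioPow p q (w d)
∑-mergeOp-ratioPow p q c d = begin
  ratioPow p q (w (single m)) + 0ℚ   ≡⟨ ℚP.+-identityʳ _ ⟩
  ratioPow p q (w (single m))        ≡⟨ cong (ratioPow p q) (proj₂ (single-composition m)) ⟩
  ratioPow p q m                     ≡⟨ ratioPow-+ p q (w c) (w d) ⟨
  ratioPow p q (w c) * ratioPow p q (w d) ∎
  where
  open ≡-Reasoning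
  m = w c ℕ.+ w d

evaluate : ℕ → ℕ → (List ℕ → ℚ) → ℕ → ℚ
evaluate p q γ n = ∑[ c ← compsBelow n ] (γ c * ratioPow p q (w c))

evaluate-convolve-mergeOp : ∀ p q γ η n →
  ∑[ c ← compsBelow n ] ∑[ d ← compsBelow n ] (γ c * η d * ∑[ u ← mergeOp c d ] ratioPow p q (w u)) ≡
  evaluate p q γ n * evaluate p q η n
evaluate-convolve-mergeOp p q γ η n = trans
  (∑-cong (compsBelow n) λ c → ∑-cong (compsBelow n) λ d →
    trans (cong (γ c * η d *_) (∑-mergeOp-ratioPow p q c d))
          (solve 4 (λ a b x y → a :* b :* (x :* y) := (a :* x) :* (b :* y)) refl (γ c) (η d) (ratioPow p q (w c)) (ratioPow p q (w d))))
  (sym (∑-*-∑ (compsBelow n) (compsBelow n) _ _))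
  where open ℚSolver.+-*-Solver

p∤-shift : ∀ {p} r j → ¬ p ∣ suc j → ¬ p ∣ suc (p ℕ.* r ℕ.+ j)
p∤-shift {p} r j p∤j+1 p∣ = p∤j+1 (ℕD.∣m+n∣m⇒∣n (subst (p ∣_) (sym (ℕP.+-suc (p ℕ.* r) j)) p∣) (ℕD.m∣m*n r))

module Geometric (r : ℕ) where

  -- With x = p / (j + 1), p / (p r + j + 1) = x / (1 + r x) = ∑ₘ (- r) ^ (m - 1) xᵐ;
  -- geometric k encodes the (k + 1)-st power of this series.
  coefficient : ℕ → ℚ
  coefficient zero    = 0ℚ
  coefficient (suc k) = (- ℕ→ℚ r) ^ᵠ k

  geometric : ℕ → List ℕ → ℚ
  geometric zero    = onSingles coefficient
  geometric (suc k) = convolve mergeOp (geometric k) (geometric zero)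

  geometric-[] : ∀ k → geometric k [] ≡ 0ℚ
  geometric-[] zero    = refl
  geometric-[] (suc k) = trans (ℚP.+-identityʳ _) (trans (ℚP.+-identityʳ _)
    (trans (cong (λ z → z * 0ℚ * (δ [] [] + 0ℚ)) (geometric-[] k))
           (trans (cong (_* (δ [] [] + 0ℚ)) (ℚP.*-zeroˡ 0ℚ)) (ℚP.*-zeroˡ (δ [] [] + 0ℚ)))))

  geometricBound : ℕ → ℕ → ℕ
  geometricBound zero    n = 0
  geometricBound (suc k) n = geometricBound k n ⊔ (denominatorBound (geometric k) n ⊔ denominatorBound (geometric zero) n)

  module _ {p : ℕ} ⦃ p-prime : Prime p ⦄ (j : ℕ) (p∤j+1 : ¬ p ∣ suc j) where

    private
      R P I₁ I₂ : ℚ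
      R = ℕ→ℚ r
      P = ℕ→ℚ p
      I₁ = inv-pow j 1
      I₂ = inv-pow (p ℕ.* r ℕ.+ j) 1

      p∤shifted : ¬ p ∣ suc (p ℕ.* r ℕ.+ j)
      p∤shifted = p∤-shift r j p∤j+1

      inv-difference : I₁ - I₂ ≡ R * P * I₁ * I₂
      inv-difference = begin
        I₁ - I₂
          ≡⟨ solve 2 (λ a b → a :- b := a :* con 1ℚ :- b :* con 1ℚ) refl I₁ I₂ ⟩
        I₁ * 1ℚ - I₂ * 1ℚ
          ≡⟨ cong₂ (λ u v → I₁ * u - I₂ * v) (sym (inv-pow-inverse (p ℕ.* r ℕ.+ j) 1)) (sym (inv-pow-inverse j 1)) ⟩
        I₁ * (N₂ * I₂) - I₂ * (N₁ * I₁)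
          ≡⟨ solve 4 (λ a b k l → a :* (k :* b) :- b :* (l :* a) := a :* b :* (k :- l)) refl I₁ I₂ N₂ N₁ ⟩
        I₁ * I₂ * (N₂ - N₁)
          ≡⟨ cong (λ z → I₁ * I₂ * (z - N₁)) N₂≡PR+N₁ ⟩
        I₁ * I₂ * (P * R + N₁ - N₁)
          ≡⟨ solve 5 (λ a b x y l → a :* b :* (x :* y :+ l :- l) := y :* x :* a :* b) refl I₁ I₂ P R N₁ ⟩
        R * P * I₁ * I₂ ∎
        where
        open ≡-Reasoning
        open ℚSolver.+-*-Solver
        N₁ N₂ : ℚ
        N₁ = ℕ→ℚ (suc j ^ 1)
        N₂ = ℕ→ℚ (suc (p ℕ.* r ℕ.+ j) ^ 1)
        shifted-denominator : suc (p ℕ.* r ℕ.+ j) ^ 1 ≡ p ℕ.* r ℕ.+ suc j ^ 1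
        shifted-denominator = trans (ℕP.*-identityʳ _)
          (trans (sym (ℕP.+-suc (p ℕ.* r) j)) (cong (p ℕ.* r ℕ.+_) (sym (ℕP.*-identityʳ (suc j)))))
        N₂≡PR+N₁ : N₂ ≡ P * R + N₁
        N₂≡PR+N₁ = trans (cong ℕ→ℚ shifted-denominator) (trans (ℕ→ℚ-+ (p ℕ.* r) (suc j ^ 1)) (cong (_+ N₁) (ℕ→ℚ-* p r)))

      partialSum : ℕ → ℚ
      partialSum m = sumTo m (λ i → onSingles (λ k → coefficient k * ratioPow p j k) (single i))

      geometric-remainder : ∀ m →
        ratioPow p (p ℕ.* r ℕ.+ j) 1 - partialSum (suc m) ≡ p ^ℚ suc m * ((- R) ^ᵠ m * inv-pow j m * I₂)
      geometric-remainder zero =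
        solve 2 (λ x b → x :* b :- (con 0ℚ :+ con 0ℚ) := x :* (con 1ℚ :* con 1ℚ :* b)) refl (p ^ℚ 1) I₂
        where open ℚSolver.+-*-Solver
      geometric-remainder (suc m) = begin
        p ^ℚ 1 * I₂ - (S + Q * (W * inv-pow j (suc m)))
          ≡⟨ solve 5 (λ a S Q W V → a :- (S :+ Q :* (W :* V)) := (a :- S) :- Q :* W :* V) refl (p ^ℚ 1 * I₂) S Q W (inv-pow j (suc m)) ⟩
        (p ^ℚ 1 * I₂ - S) - Q * W * inv-pow j (suc m)
          ≡⟨ cong₂ (λ u v → u - Q * W * v) (geometric-remainder m) (sym (inv-pow-+ j 1 m)) ⟩
        W * (Q * X * I₂) - Q * W * (I₁ * X)
          ≡⟨ solve 5 (λ W Q X a b → W :* (Q :* X :* b) :- Q :* W :* (a :* X) := W :* Q :* X :* (:- (a :- b))) refl W Q X I₁ I₂ ⟩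
        W * Q * X * (- (I₁ - I₂))
          ≡⟨ cong (λ z → W * Q * X * (- z)) inv-difference ⟩
        W * Q * X * (- (R * P * I₁ * I₂))
          ≡⟨ solve 7 (λ W Q X a b x y → W :* Q :* X :* (:- (x :* y :* a :* b)) := (y :* W) :* ((:- x) :* Q :* (a :* X) :* b))
                     refl W Q X I₁ I₂ R P ⟩
        (P * W) * ((- R) * Q * (I₁ * X) * I₂)
          ≡⟨ cong₂ (λ u v → u * ((- R) * Q * v * I₂)) (sym (ℕ→ℚ-* p (p ^ suc m))) (inv-pow-+ j 1 m) ⟩
        p ^ℚ suc (suc m) * ((- R) ^ᵠ suc m * inv-pow j (suc m) * I₂) ∎
        where
        open ≡-Reasoning
        open ℚSolver.+-*-Solver
        S = partialSum (suc m)
        Q = (- R) ^ᵠ m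
        W = p ^ℚ suc m
        X = inv-pow j m

    integral-^ᵠ : ∀ {x} k → Integral p x → Integral p (x ^ᵠ k)
    integral-^ᵠ zero    ix = integral-1
    integral-^ᵠ (suc k) ix = integral-* ix (integral-^ᵠ k ix)

    evaluate-geometric-zero : ∀ n → evaluate p j (geometric zero) n ≡ ratioPow p (p ℕ.* r ℕ.+ j) 1 [mod p ^ n ]
    evaluate-geometric-zero zero    = ≡mod-^0 integral-0 (integral-ratioPow _ 1 p∤shifted)
    evaluate-geometric-zero (suc m) = ≡mod-sym (congruent _ integral-quotient
      (trans (cong (λ z → ratioPow p (p ℕ.* r ℕ.+ j) 1 - z) evaluate≡partialSum) (geometric-remainder m)))
      where
      integral-quotient : Integral p ((- R) ^ᵠ m * inv-pow j m * I₂)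
      integral-quotient = integral-* (integral-* (integral-^ᵠ m (integral-neg (integral-ℕ r))) (integral-inv-pow j m p∤j+1))
                                     (integral-inv-pow _ 1 p∤shifted)
      evaluate≡partialSum : evaluate p j (geometric zero) (suc m) ≡ partialSum (suc m)
      evaluate≡partialSum = trans (∑-cong (compsBelow (suc m)) onSingles-*) (∑-compsBelow-onSingles (suc m) _)
        where
        onSingles-* : ∀ c → onSingles coefficient c * ratioPow p j (w c) ≡ onSingles (λ k → coefficient k * ratioPow p j k) c
        onSingles-* []               = ℚP.*-zeroˡ (ratioPow p j 0)
        onSingles-* (y ∷ [])         = cong (λ k → coefficient y * ratioPow p j k) (ℕP.+-identityʳ y)
        onSingles-* c@(_ ∷ _ ∷ _)    = ℚP.*-zeroˡ (ratioPow p j (w c))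

    evaluate-geometric : ∀ k n → geometricBound k n ≤ p →
      evaluate p j (geometric k) n ≡ ratioPow p (p ℕ.* r ℕ.+ j) (suc k) [mod p ^ n ]
    evaluate-geometric zero    n _   = evaluate-geometric-zero n
    evaluate-geometric (suc k) n k≤p =
      ≡mod-trans (∑-convolve-≡mod n (λ u → inv-pow j (w u)) (λ u _ → integral-inv-pow j (w u) p∤j+1) iγ iβ)
      (≡mod-trans (≡⇒≡mod (evaluate-convolve-mergeOp p j (geometric k) (geometric zero) n))
      (≡mod-trans (≡mod-* (∑-integral _ iγ λ {c} iγc → integral-* iγc (integral-ratioPow j (w c) p∤j+1))
                          (integral-ratioPow _ 1 p∤shifted)
                          (evaluate-geometric k n (ℕP.m⊔n≤o⇒m≤o (geometricBound k n) _ k≤p)) (evaluate-geometric-zero n))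
                  (≡⇒≡mod (trans (ratioPow-+ p _ (suc k) 1) (cong (ratioPow p _) (ℕP.+-comm (suc k) 1))))))
      where
      open Convolution mergeOp mergeOp-additive (geometric k) (geometric zero)
      Bγ = denominatorBound (geometric k) n
      Bβ = denominatorBound (geometric zero) n
      bounds : Bγ ⊔ Bβ ≤ p
      bounds = ℕP.m⊔n≤o⇒n≤o (geometricBound k n) _ k≤p
      iγ = integral-coefficients (geometric k) n (ℕP.m⊔n≤o⇒m≤o Bγ Bβ bounds)
      iβ = integral-coefficients (geometric zero) n (ℕP.m⊔n≤o⇒n≤o Bγ Bβ bounds)

-- Shifted harmonic sums

-- As in H, the summation index j stands for the integer j + 1.
nested : (ℕ → ℕ → ℚ) → ℕ → List ℕ → ℚ
nested f N []       = 1ℚ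
nested f N (s ∷ ss) = sumTo N (λ j → f j s * nested f j ss)

w-++ : ∀ a b → w (a ++ b) ≡ w a ℕ.+ w b
w-++ []      b = refl
w-++ (x ∷ a) b = trans (cong (x ℕ.+_) (w-++ a b)) (sym (ℕP.+-assoc x (w a) (w b)))

prependOp : CompositionOp
prependOp c d = (single (w c) ++ d) ∷ []

prependOp-additive : WeightAdditive prependOp
prependOp-additive c d _ cd = (AllP.++⁺ (proj₁ (single-composition (w c))) cd ,
  trans (w-++ (single (w c)) d) (cong (ℕ._+ w d) (proj₂ (single-composition (w c))))) ∷ []

∑-prependOp-H : ∀ p N (γ η : List ℕ → ℚ) → γ [] ≡ 0ℚ → ∀ c d → IsComposition c →
  γ c * η d * ∑[ u ← prependOp c d ] (p ^ℚ w u * H N u) ≡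
  sumTo N (λ j → γ c * ratioPow p j (w c) * (η d * (p ^ℚ w d * H j d)))
∑-prependOp-H p N γ η γ[]≡0 [] d _ = begin
  γ [] * η d * (p ^ℚ w d * H N d + 0ℚ)
    ≡⟨ cong (λ z → z * η d * (p ^ℚ w d * H N d + 0ℚ)) γ[]≡0 ⟩
  0ℚ * η d * (p ^ℚ w d * H N d + 0ℚ)
    ≡⟨ zero-product (η d) _ ⟩
  0ℚ
    ≡⟨ sumTo-zero N _ (λ j _ → trans (cong (λ z → z * ratioPow p j 0 * _) γ[]≡0)
                                      (zero-product (ratioPow p j 0) (η d * (p ^ℚ w d * H j d)))) ⟨
  sumTo N (λ j → γ [] * ratioPow p j 0 * (η d * (p ^ℚ w d * H j d))) ∎
  where
  open ≡-Reasoning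
  zero-product : ∀ a b → 0ℚ * a * b ≡ 0ℚ
  zero-product a b = trans (cong (_* b) (ℚP.*-zeroˡ a)) (ℚP.*-zeroˡ b)
∑-prependOp-H p N γ η γ[]≡0 c@(suc y ∷ c′) d _ = begin
  G * (p ^ℚ (suc m ℕ.+ w d) * sumTo N (λ j → inv-pow j (suc m) * H j d) + 0ℚ)
    ≡⟨ cong (G *_) (ℚP.+-identityʳ _) ⟩
  G * (p ^ℚ (suc m ℕ.+ w d) * sumTo N (λ j → inv-pow j (suc m) * H j d))
    ≡⟨ cong (λ z → G * (z * sumTo N (λ j → inv-pow j (suc m) * H j d))) (^ℚ-+ p (suc m) (w d)) ⟩
  G * ((p ^ℚ suc m * p ^ℚ w d) * sumTo N (λ j → inv-pow j (suc m) * H j d))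
    ≡⟨ ℚP.*-assoc G (p ^ℚ suc m * p ^ℚ w d) _ ⟨
  G * (p ^ℚ suc m * p ^ℚ w d) * sumTo N (λ j → inv-pow j (suc m) * H j d)
    ≡⟨ sumTo-*ˡ N (G * (p ^ℚ suc m * p ^ℚ w d)) _ ⟩
  sumTo N (λ j → G * (p ^ℚ suc m * p ^ℚ w d) * (inv-pow j (suc m) * H j d))
    ≡⟨ sumTo-cong N (λ j _ → solve 6 (λ g e x y u h → g :* e :* (x :* y) :* (u :* h) := g :* (x :* u) :* (e :* (y :* h))) refl
                                      (γ c) (η d) (p ^ℚ suc m) (p ^ℚ w d) (inv-pow j (suc m)) (H j d)) ⟩
  sumTo N (λ j → γ c * ratioPow p j (suc m) * (η d * (p ^ℚ w d * H j d))) ∎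
  where
  open ≡-Reasoning
  open ℚSolver.+-*-Solver
  m = y ℕ.+ w c′
  G = γ c * η d
∑-prependOp-H p N γ η γ[]≡0 (zero ∷ _) d (() ∷ _)

sumTo-evaluate-* : ∀ p N (γ η : List ℕ → ℚ) n → γ [] ≡ 0ℚ →
  sumTo N (λ j → evaluate p j γ n * ∑[ t ← compsBelow n ] (η t * (p ^ℚ w t * H j t))) ≡
  ∑[ c ← compsBelow n ] ∑[ d ← compsBelow n ] (γ c * η d * ∑[ u ← prependOp c d ] (p ^ℚ w u * H N u))
sumTo-evaluate-* p N γ η n γ[]≡0 = begin
  sumTo N (λ j → evaluate p j γ n * ∑[ d ← C ] Y j d)
    ≡⟨ sumTo-cong N (λ j _ → ∑-*-∑ C C (X j) (Y j)) ⟩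
  sumTo N (λ j → ∑[ c ← C ] ∑[ d ← C ] (X j c * Y j d))
    ≡⟨ ∑-sumTo-comm C N (λ c j → ∑[ d ← C ] (X j c * Y j d)) ⟨
  ∑[ c ← C ] sumTo N (λ j → ∑[ d ← C ] (X j c * Y j d))
    ≡⟨ ∑-cong C (λ c → ∑-sumTo-comm C N (λ d j → X j c * Y j d)) ⟨
  ∑[ c ← C ] ∑[ d ← C ] sumTo N (λ j → X j c * Y j d)
    ≡⟨ ∑-congᴬ (compsBelow-weight n) (λ {c} (cc , _) → ∑-cong C λ d → ∑-prependOp-H p N γ η γ[]≡0 c d cc) ⟨
  ∑[ c ← C ] ∑[ d ← C ] (γ c * η d * ∑[ u ← prependOp c d ] (p ^ℚ w u * H N u)) ∎
  where
  open ≡-Reasoning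
  C = compsBelow n
  X : ℕ → List ℕ → ℚ
  X j c = γ c * ratioPow p j (w c)
  Y : ℕ → List ℕ → ℚ
  Y j d = η d * (p ^ℚ w d * H j d)

module Shifted (r : ℕ) where
  open Geometric r

  shifted : List ℕ → List ℕ → ℚ
  shifted []      = δ []
  shifted (x ∷ a) = convolve prependOp (geometric (x ℕ.∸ 1)) (shifted a)

  shiftedBound : List ℕ → ℕ → ℕ
  shiftedBound []      n = 0
  shiftedBound (x ∷ a) n =
    shiftedBound a n ⊔ (geometricBound (x ℕ.∸ 1) n ⊔ (denominatorBound (geometric (x ℕ.∸ 1)) n ⊔ denominatorBound (shifted a) n))

  module _ {p : ℕ} ⦃ p-prime : Prime p ⦄ where

    M : ℕ
    M = p ℕ.* r

    expansion : List ℕ → ℕ → ℕ → ℚ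
    expansion a n N = ∑[ t ← compsBelow n ] (shifted a t * (p ^ℚ w t * H N t))

    shifted-≡mod : ∀ a → IsComposition a → ∀ n → shiftedBound a n ≤ p → ∀ N → N < p →
      p ^ℚ w a * nested (λ j → inv-pow (M ℕ.+ j)) N a ≡ expansion a n N [mod p ^ n ]
    shifted-≡mod [] _ zero    _ N _ = ≡mod-^0 (integral-* (integral-^ℚ 0) integral-1) integral-0
    shifted-≡mod [] _ (suc n) _ N _ = ≡⇒≡mod (sym (trans (∑-compsBelow-δ (suc n) [] (λ t → p ^ℚ w t * H N t) [])
                                                            (ℚP.*-identityˡ _)))
    shifted-≡mod (suc k ∷ a) (_ ∷ ca) n a≤p N N<p =
      ≡mod-trans (≡⇒≡mod first-part-factored)
      (≡mod-trans (sumTo-≡mod N _ _ λ j j<N →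
                     ≡mod-* (integral-ratioPow (M ℕ.+ j) (suc k) (p∤-shift r j (p∤ j j<N))) (expansion-integral j j<N)
                            (≡mod-sym (evaluate-geometric j (p∤ j j<N) k n β≤p))
                            (shifted-≡mod a ca n IH≤p j (ℕP.<-trans j<N N<p)))
      (≡mod-trans (≡⇒≡mod (sumTo-evaluate-* p N (geometric k) (shifted a) n (geometric-[] k)))
                  (≡mod-sym (∑-convolve-≡mod n (H N) (λ u _ → H-integral u N N<p) iγ iα))))
      where
      open Convolution prependOp prependOp-additive (geometric k) (shifted a)
      p∤ : ∀ j → j < N → ¬ p ∣ suc j
      p∤ j j<N = p∤-nonzero-< (s≤s z≤n) (ℕP.≤-<-trans j<N N<p)
      IH≤p : shiftedBound a n ≤ p
      IH≤p = ℕP.m⊔n≤o⇒m≤o (shiftedBound a n) _ a≤p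
      Bγ = denominatorBound (geometric k) n
      Bα = denominatorBound (shifted a) n
      rest : geometricBound k n ⊔ (Bγ ⊔ Bα) ≤ p
      rest = ℕP.m⊔n≤o⇒n≤o (shiftedBound a n) _ a≤p
      β≤p : geometricBound k n ≤ p
      β≤p = ℕP.m⊔n≤o⇒m≤o (geometricBound k n) _ rest
      iγ = integral-coefficients (geometric k) n (ℕP.m⊔n≤o⇒m≤o Bγ Bα (ℕP.m⊔n≤o⇒n≤o (geometricBound k n) _ rest))
      iα = integral-coefficients (shifted a) n (ℕP.m⊔n≤o⇒n≤o Bγ Bα (ℕP.m⊔n≤o⇒n≤o (geometricBound k n) _ rest))
      expansion-integral : ∀ j → j < N → Integral p (expansion a n j)
      expansion-integral j j<N = ∑-integral _ iα λ {d} iαd →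
        integral-* iαd (integral-* (integral-^ℚ (w d)) (H-integral d j (ℕP.<-trans j<N N<p)))
      f : ℕ → ℕ → ℚ
      f j = inv-pow (M ℕ.+ j)
      first-part-factored : p ^ℚ w (suc k ∷ a) * nested f N (suc k ∷ a) ≡
                            sumTo N (λ j → ratioPow p (M ℕ.+ j) (suc k) * (p ^ℚ w a * nested f j a))
      first-part-factored = trans (cong (_* nested f N (suc k ∷ a)) (^ℚ-+ p (suc k) (w a)))
        (trans (sumTo-*ˡ N (p ^ℚ suc k * p ^ℚ w a) (λ j → f j (suc k) * nested f j a))
               (sumTo-cong N (λ j _ → solve 4 (λ x y u t → x :* y :* (u :* t) := x :* u :* (y :* t)) refl
                                               (p ^ℚ suc k) (p ^ℚ w a) (f j (suc k)) (nested f j a))))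
        where open ℚSolver.+-*-Solver

-- Splitting the range of summation

splits : List ℕ → List (List ℕ × List ℕ)
splits []      = ([] , []) ∷ []
splits (x ∷ s) = ([] , x ∷ s) ∷ map (λ (a , b) → x ∷ a , b) (splits s)

splits-++ : ∀ s → All (λ (a , b) → a ++ b ≡ s) (splits s)
splits-++ []      = refl ∷ []
splits-++ (x ∷ s) = refl ∷ AllP.map⁺ (All.map (cong (x ∷_)) (splits-++ s))

module _ (f : ℕ → ℕ → ℚ) (M : ℕ) where

  private
    f′ : ℕ → ℕ → ℚ
    f′ i = f (M ℕ.+ i)

    split-sum : ℕ → List ℕ → ℚ
    split-sum d s = ∑[ ab ← splits s ] (nested f′ d (proj₁ ab) * nested f M (proj₂ ab))

    split-sum-[] : ∀ d → split-sum d [] ≡ 1ℚ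
    split-sum-[] d = ℚP.+-identityʳ (1ℚ * 1ℚ)

    split-sum-∷ : ∀ d x ss → split-sum d (x ∷ ss) ≡
      nested f M (x ∷ ss) + ∑[ ab ← splits ss ] (nested f′ d (x ∷ proj₁ ab) * nested f M (proj₂ ab))
    split-sum-∷ d x ss = cong₂ _+_ (ℚP.*-identityˡ (nested f M (x ∷ ss)))
      (∑-map (λ (a , b) → x ∷ a , b) (splits ss) (λ ab → nested f′ d (proj₁ ab) * nested f M (proj₂ ab)))

    split-sum-suc : ∀ d x ss → split-sum (suc d) (x ∷ ss) ≡ split-sum d (x ∷ ss) + f′ d x * split-sum d ss
    split-sum-suc d x ss = begin
      split-sum (suc d) (x ∷ ss)
        ≡⟨ split-sum-∷ (suc d) x ss ⟩
      nested f M (x ∷ ss) + ∑[ ab ← S ] ((nested f′ d (x ∷ proj₁ ab) + f′ d x * nested f′ d (proj₁ ab)) * nested f M (proj₂ ab))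
        ≡⟨ cong (nested f M (x ∷ ss) +_) (trans (∑-cong S λ ab → ℚP.*-distribʳ-+ (nested f M (proj₂ ab)) (nested f′ d (x ∷ proj₁ ab)) (f′ d x * nested f′ d (proj₁ ab)))
                                                 (∑-+ S (λ ab → nested f′ d (x ∷ proj₁ ab) * nested f M (proj₂ ab))
                                                        (λ ab → f′ d x * nested f′ d (proj₁ ab) * nested f M (proj₂ ab)))) ⟩
      nested f M (x ∷ ss) + (∑[ ab ← S ] (nested f′ d (x ∷ proj₁ ab) * nested f M (proj₂ ab))
                            + ∑[ ab ← S ] (f′ d x * nested f′ d (proj₁ ab) * nested f M (proj₂ ab)))
        ≡⟨ ℚP.+-assoc (nested f M (x ∷ ss)) _ _ ⟨
      (nested f M (x ∷ ss) + ∑[ ab ← S ] (nested f′ d (x ∷ proj₁ ab) * nested f M (proj₂ ab)))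
        + ∑[ ab ← S ] (f′ d x * nested f′ d (proj₁ ab) * nested f M (proj₂ ab))
        ≡⟨ cong₂ _+_ (sym (split-sum-∷ d x ss))
                     (trans (∑-cong S λ ab → ℚP.*-assoc (f′ d x) (nested f′ d (proj₁ ab)) (nested f M (proj₂ ab)))
                            (sym (∑-*ˡ S (f′ d x) (λ ab → nested f′ d (proj₁ ab) * nested f M (proj₂ ab))))) ⟩
      split-sum d (x ∷ ss) + f′ d x * split-sum d ss ∎
      where
      open ≡-Reasoning
      S = splits ss

  nested-split : ∀ d s → nested f (M ℕ.+ d) s ≡ ∑[ ab ← splits s ] (nested f′ d (proj₁ ab) * nested f M (proj₂ ab))
  nested-split zero [] = sym (split-sum-[] 0)
  nested-split zero (x ∷ ss) rewrite ℕP.+-identityʳ M = sym (begin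
    split-sum 0 (x ∷ ss)                      ≡⟨ split-sum-∷ 0 x ss ⟩
    nested f M (x ∷ ss) + ∑[ ab ← splits ss ] (0ℚ * nested f M (proj₂ ab))
      ≡⟨ cong (nested f M (x ∷ ss) +_) (∑-zero (splits ss) λ ab → ℚP.*-zeroˡ (nested f M (proj₂ ab))) ⟩
    nested f M (x ∷ ss) + 0ℚ                  ≡⟨ ℚP.+-identityʳ _ ⟩
    nested f M (x ∷ ss)                       ∎)
    where open ≡-Reasoning
  nested-split (suc d) [] = sym (split-sum-[] (suc d))
  nested-split (suc d) (x ∷ ss) rewrite ℕP.+-suc M d = begin
    nested f (M ℕ.+ d) (x ∷ ss) + f (M ℕ.+ d) x * nested f (M ℕ.+ d) ss
      ≡⟨ cong₂ (λ u v → u + f (M ℕ.+ d) x * v) (nested-split d (x ∷ ss)) (nested-split d ss) ⟩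
    split-sum d (x ∷ ss) + f′ d x * split-sum d ss
      ≡⟨ split-sum-suc d x ss ⟨
    split-sum (suc d) (x ∷ ss) ∎
    where open ≡-Reasoning

nested-cong : ∀ {f g} N a → (∀ j s → j < N → f j s ≡ g j s) → nested f N a ≡ nested g N a
nested-cong N []      f≡g = refl
nested-cong N (x ∷ a) f≡g = sumTo-cong N λ j j<N →
  cong₂ _*_ (f≡g j x j<N) (nested-cong j a (λ i s i<j → f≡g i s (ℕP.<-trans i<j j<N)))

coprimeTerm : ℕ → ℕ → ℕ → ℚ
coprimeTerm p j s with p ∣? suc j
... | yes _ = 0ℚ
... | no _  = inv-pow j s

Hp-suc : ∀ p N x ss → Hp p (suc N) (x ∷ ss) ≡ Hp p N (x ∷ ss) + coprimeTerm p N x * Hp p N ss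
Hp-suc p N x ss with p ∣? suc N
... | yes _ = cong (Hp p N (x ∷ ss) +_) (sym (ℚP.*-zeroˡ (Hp p N ss)))
... | no _  = refl

Hp≡nested : ∀ p N s → Hp p N s ≡ nested (coprimeTerm p) N s
Hp≡nested p N       []       = refl
Hp≡nested p zero    (x ∷ ss) = refl
Hp≡nested p (suc N) (x ∷ ss) = trans (Hp-suc p N x ss)
  (cong₂ (λ u v → u + coprimeTerm p N x * v) (Hp≡nested p N (x ∷ ss)) (Hp≡nested p N ss))

-- In the block (p r, p r + p] only the last index is divisible by p.
block≡shifted : ∀ {p} ⦃ _ : Prime p ⦄ r a →
  nested (λ i → coprimeTerm p (p ℕ.* r ℕ.+ i)) p a ≡ nested (λ i → inv-pow (p ℕ.* r ℕ.+ i)) (p ℕ.∸ 1) a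
block≡shifted {p@(suc q)} r [] = refl
block≡shifted {p@(suc q)} r (x ∷ a) = begin
  nested f q (x ∷ a) + coprimeTerm p (M ℕ.+ q) x * nested f q a
    ≡⟨ cong (λ z → nested f q (x ∷ a) + z * nested f q a) last-vanishes ⟩
  nested f q (x ∷ a) + 0ℚ * nested f q a
    ≡⟨ trans (cong (nested f q (x ∷ a) +_) (ℚP.*-zeroˡ (nested f q a))) (ℚP.+-identityʳ _) ⟩
  nested f q (x ∷ a)
    ≡⟨ nested-cong q (x ∷ a) coprime-below ⟩
  nested (λ i → inv-pow (M ℕ.+ i)) q (x ∷ a) ∎
  where
  open ≡-Reasoning
  M = p ℕ.* r
  f : ℕ → ℕ → ℚ
  f i = coprimeTerm p (M ℕ.+ i)
  p∣last : p ∣ suc (M ℕ.+ q)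
  p∣last = divides (suc r) (solve 2 (λ q r → con 1 :+ ((con 1 :+ q) :* r :+ q) := (con 1 :+ r) :* (con 1 :+ q)) refl q r)
    where open ℕSolver.+-*-Solver
  last-vanishes : coprimeTerm p (M ℕ.+ q) x ≡ 0ℚ
  last-vanishes with p ∣? suc (M ℕ.+ q)
  ... | yes _   = refl
  ... | no p∤ = ⊥-elim (p∤ p∣last)
  coprime-below : ∀ i s → i < q → f i s ≡ inv-pow (M ℕ.+ i) s
  coprime-below i s i<q with p ∣? suc (M ℕ.+ i)
  ... | yes p∣ = ⊥-elim (p∤-shift r i (p∤-nonzero-< (s≤s z≤n) (s≤s i<q)) p∣)
  ... | no _   = refl

representable-shifted : ∀ r a → IsComposition a →
  Representable (λ p → p ^ℚ w a * nested (λ j → inv-pow (p ℕ.* r ℕ.+ j)) (p ℕ.∸ 1) a)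
representable-shifted r a ca = shifted a , λ n → shiftedBound a n , λ p a≤p →
  ≡mod-trans (shifted-≡mod a ca n a≤p (p ℕ.∸ 1) p∸1<p)
             (≡⇒≡mod (∑-cong (compsBelow n) λ t → sym (ℚP.*-assoc (shifted a t) (p ^ℚ w t) (Hₚ₋₁ p t))))
  where open Shifted r

block-factorisation : ∀ p ⦃ _ : Prime p ⦄ r s →
  p ^ℚ w s * Hp p (p ℕ.* suc r) s ≡
  ∑[ ab ← splits s ] ((p ^ℚ w (proj₁ ab) * nested (λ j → inv-pow (p ℕ.* r ℕ.+ j)) (p ℕ.∸ 1) (proj₁ ab))
                      * (p ^ℚ w (proj₂ ab) * Hp p (p ℕ.* r) (proj₂ ab)))
block-factorisation p r s = begin
  p ^ℚ w s * Hp p (p ℕ.* suc r) s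
    ≡⟨ cong (λ N → p ^ℚ w s * Hp p N s) (trans (ℕP.*-suc p r) (ℕP.+-comm p M)) ⟩
  p ^ℚ w s * Hp p (M ℕ.+ p) s
    ≡⟨ cong (p ^ℚ w s *_) (trans (Hp≡nested p (M ℕ.+ p) s) (nested-split (coprimeTerm p) M p s)) ⟩
  p ^ℚ w s * ∑[ ab ← splits s ] (nested g′ p (proj₁ ab) * nested g M (proj₂ ab))
    ≡⟨ ∑-*ˡ (splits s) (p ^ℚ w s) _ ⟩
  ∑[ ab ← splits s ] (p ^ℚ w s * (nested g′ p (proj₁ ab) * nested g M (proj₂ ab)))
    ≡⟨ ∑-congᴬ (splits-++ s) (λ {ab} a++b≡s → factor (proj₁ ab) (proj₂ ab) a++b≡s) ⟩
  ∑[ ab ← splits s ] ((p ^ℚ w (proj₁ ab) * nested (λ j → inv-pow (M ℕ.+ j)) (p ℕ.∸ 1) (proj₁ ab))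
                      * (p ^ℚ w (proj₂ ab) * Hp p M (proj₂ ab))) ∎
  where
  open ≡-Reasoning
  open ℚSolver.+-*-Solver
  M = p ℕ.* r
  g = coprimeTerm p
  g′ : ℕ → ℕ → ℚ
  g′ i = g (M ℕ.+ i)
  factor : ∀ a b → a ++ b ≡ s → p ^ℚ w s * (nested g′ p a * nested g M b) ≡
           (p ^ℚ w a * nested (λ j → inv-pow (M ℕ.+ j)) (p ℕ.∸ 1) a) * (p ^ℚ w b * Hp p M b)
  factor a b refl = begin
    p ^ℚ w (a ++ b) * (nested g′ p a * nested g M b)
      ≡⟨ cong₂ (λ z u → z * (u * nested g M b)) (trans (cong (p ^ℚ_) (w-++ a b)) (^ℚ-+ p (w a) (w b))) (block≡shifted r a) ⟩
    (p ^ℚ w a * p ^ℚ w b) * (nested (λ j → inv-pow (M ℕ.+ j)) (p ℕ.∸ 1) a * nested g M b)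
      ≡⟨ cong (λ z → (p ^ℚ w a * p ^ℚ w b) * (nested (λ j → inv-pow (M ℕ.+ j)) (p ℕ.∸ 1) a * z)) (sym (Hp≡nested p M b)) ⟩
    (p ^ℚ w a * p ^ℚ w b) * (nested (λ j → inv-pow (M ℕ.+ j)) (p ℕ.∸ 1) a * Hp p M b)
      ≡⟨ solve 4 (λ x y u v → (x :* y) :* (u :* v) := (x :* u) :* (y :* v)) refl
                 (p ^ℚ w a) (p ^ℚ w b) (nested (λ j → inv-pow (M ℕ.+ j)) (p ℕ.∸ 1) a) (Hp p M b) ⟩
    (p ^ℚ w a * nested (λ j → inv-pow (M ℕ.+ j)) (p ℕ.∸ 1) a) * (p ^ℚ w b * Hp p M b) ∎

representable-Hp : ∀ r s → IsComposition s → Representable (λ p → p ^ℚ w s * Hp p (p ℕ.* r) s)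
representable-Hp zero []      _  = representable-cong (λ p _ → sym (ℚP.*-identityˡ 1ℚ)) (representable-const 1ℚ)
representable-Hp zero (x ∷ s) _  = representable-cong empty-range representable-0
  where
  empty-range : ∀ p → Prime p → 0ℚ ≡ p ^ℚ w (x ∷ s) * Hp p (p ℕ.* 0) (x ∷ s)
  empty-range p _ = sym (trans (cong (λ N → p ^ℚ w (x ∷ s) * Hp p N (x ∷ s)) (ℕP.*-zeroʳ p)) (ℚP.*-zeroʳ (p ^ℚ w (x ∷ s))))
representable-Hp (suc r) s cs =
  representable-cong (λ p p-prime → sym (block-factorisation p ⦃ p-prime ⦄ r s))
    (representable-∑ (splits s) _ (All.map (λ {ab} a++b≡s →
      let cab = subst IsComposition (sym a++b≡s) cs in
      representable-* (representable-shifted r (proj₁ ab) (AllP.++⁻ˡ (proj₁ ab) cab))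
                      (representable-Hp r (proj₂ ab) (AllP.++⁻ʳ (proj₁ ab) cab))) (splits-++ s)))

representable⇒AsympRep : ∀ {a} → Representable a → AsympRep a
representable⇒AsympRep (α , a≡α) = α , λ n _ → let (P , a≡) = a≡α n in
  P , λ p p-prime P≤p → let instance _ = p-prime in
    ≡mod⇒CongMod (≡mod-trans (a≡ p P≤p) (≡⇒≡mod (sym (truncSum≡truncated α p n))))

theorem4 : (s : List ℕ) → All (1 ≤_) s → (r : ℕ) → 1 ≤ r →
    AsympRep (λ p → ℕ→ℚ (p ^ w s) Data.Rational.* Hp p (p Data.Nat.* r) s)
theorem4 s cs r _ = representable⇒AsympRep (representable-Hp r s cs)
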